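{- Let $G$ be a connected graph of order $n\geq 5$, size $m$ (number of edges), minimum degree $\delta$ and vertex-connectivity $\kappa$. If $m \geq \binom{n-2}{2}+2\delta$, then $G$ is super-$\kappa$, unless $G\cong (K_{\delta}\vee (K_2\cup K_{n-\delta-2}))-e$, where $e=xy$ is an edge of $K_{\delta}\vee (K_2\cup K_{n-\delta-2})$ such that, in $K_{\delta}\vee (K_2\cup K_{n-\delta-2})$, $x$ has degree $\delta+1$ and $y$ has degree $n-1$.
   Context: All graphs are finite, simple and undirected. A vertex-cut of a connected graph is a set of vertices whose removal disconnects it; the vertex-connectivity $\kappa(G)$ of a connected non-complete graph is the minimum size of a vertex-cut, and $\kappa(K_n)=n-1$; a minimum vertex-cut is a vertex-cut of size $\kappa(G)$. $G$ is super-connected (super-$\kappa$) if every minimum vertex-cut isolates a vertex of minimum degree (i.e., for every minimum vertex-cut $S$, some component of $G-S$ is a single vertex of degree $\delta(G)$). $K_r$ is the complete graph on $r$ vertices, $\cup$ is disjoint union, $G_1\vee G_2$ is the join (disjoint union plus all edges between $G_1$ and $G_2$), and $H-e$ denotes deletion of edge $e$. -}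

module Defs where

open import Data.Bool using (Bool; true; false; _∧_; _∨_; not; T)
open import Data.Bool.Properties using (∧-comm; ∨-comm)
open import Data.Nat using (ℕ; zero; suc; _+_; _*_; _∸_; _≤_; _<ᵇ_)
open import Data.Nat.Properties using ()
open import Data.Fin using (Fin; toℕ; splitAt; _≟_)
open import Data.Fin.Subset using (Subset; _∈_; _∉_; ∣_∣)
open import Data.Vec using (Vec; tabulate)
open import Data.List using (map; allFin)
open import Data.Nat.ListAction using (sum)
open import Data.Sum using (_⊎_; inj₁; inj₂)
open import Data.Product using (Σ; ∃; _×_; _,_)
open import Relation.Nullary using (¬_; does)
open import Relation.Binary.PropositionalEquality using (_≡_; refl; sym; trans; cong)
open import Function.Bundles using (_↔_; Inverse)

record Graph (n : ℕ) : Set where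
  field
    adj    : Fin n → Fin n → Bool
    adj-sym : ∀ i j → adj i j ≡ adj j i
    adj-irr : ∀ i → adj i i ≡ false
open Graph public

deg : ∀ {n} → Graph n → Fin n → ℕ
deg G i = ∣ tabulate (adj G i) ∣

size : ∀ {n} → Graph n → ℕ
size {n} G = sum (map (λ i → ∣ tabulate (λ j → adj G i j ∧ (toℕ i <ᵇ toℕ j)) ∣) (allFin n))

IsMinDegree : ∀ {n} → Graph n → ℕ → Set
IsMinDegree G δ = (∃ λ v → deg G v ≡ δ) × (∀ v → δ ≤ deg G v)

-- Paths in G - S (all vertices of the walk after the start avoid S)

data PathAvoid {n} (G : Graph n) (S : Subset n) : Fin n → Fin n → Set where
  here : ∀ {u} → PathAvoid G S u u
  step : ∀ {u w v} → T (adj G u w) → w ∉ S → PathAvoid G S w v → PathAvoid G S u v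

Connected : ∀ {n} → Graph n → Set
Connected {n} G = ∀ u v → PathAvoid G (Data.Fin.Subset.⊥) u v

IsVertexCut : ∀ {n} → Graph n → Subset n → Set
IsVertexCut G S = ∃ λ u → ∃ λ v → u ∉ S × v ∉ S × ¬ PathAvoid G S u v

IsMinVertexCut : ∀ {n} → Graph n → Subset n → Set
IsMinVertexCut G S = IsVertexCut G S × (∀ T → IsVertexCut G T → ∣ S ∣ ≤ ∣ T ∣)

SuperKappa : ∀ {n} → Graph n → ℕ → Set
SuperKappa {n} G δ = ∀ S → IsMinVertexCut G S →
  ∃ λ v → v ∉ S × (∀ w → T (adj G v w) → w ∈ S) × deg G v ≡ δ

K : (r : ℕ) → Graph r
adj (K r) i j = not (does (i ≟ j))
adj-sym (K r) i j with i ≟ j | j ≟ i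
... | Relation.Nullary.yes _ | Relation.Nullary.yes _ = refl
... | Relation.Nullary.no _  | Relation.Nullary.no _  = refl
... | Relation.Nullary.yes p | Relation.Nullary.no q  = Data.Empty.⊥-elim (q (sym p))
  where import Data.Empty
... | Relation.Nullary.no p  | Relation.Nullary.yes q = Data.Empty.⊥-elim (p (sym q))
  where import Data.Empty
adj-irr (K r) i with i ≟ i
... | Relation.Nullary.yes _ = refl
... | Relation.Nullary.no p  = Data.Empty.⊥-elim (p refl)
  where import Data.Empty

sumAdj : ∀ {a b} → (Fin a → Fin a → Bool) → (Fin b → Fin b → Bool) → Bool →
         Fin a ⊎ Fin b → Fin a ⊎ Fin b → Bool
sumAdj f g c (inj₁ i) (inj₁ j) = f i j
sumAdj f g c (inj₂ i) (inj₂ j) = g i j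
sumAdj f g c (inj₁ i) (inj₂ j) = c
sumAdj f g c (inj₂ i) (inj₁ j) = c

sumAdj-sym : ∀ {a b} (f : Fin a → Fin a → Bool) (g : Fin b → Fin b → Bool) c →
  (∀ i j → f i j ≡ f j i) → (∀ i j → g i j ≡ g j i) →
  ∀ x y → sumAdj f g c x y ≡ sumAdj f g c y x
sumAdj-sym f g c fs gs (inj₁ i) (inj₁ j) = fs i j
sumAdj-sym f g c fs gs (inj₂ i) (inj₂ j) = gs i j
sumAdj-sym f g c fs gs (inj₁ i) (inj₂ j) = refl
sumAdj-sym f g c fs gs (inj₂ i) (inj₁ j) = refl

sumAdj-irr : ∀ {a b} (f : Fin a → Fin a → Bool) (g : Fin b → Fin b → Bool) c →
  (∀ i → f i i ≡ false) → (∀ i → g i i ≡ false) →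
  ∀ x → sumAdj f g c x x ≡ false
sumAdj-irr f g c fi gi (inj₁ i) = fi i
sumAdj-irr f g c fi gi (inj₂ i) = gi i

-- c = false: disjoint union G ∪ H ; c = true: join G ∨ H
sumGraph : ∀ {a b} → Bool → Graph a → Graph b → Graph (a + b)
adj (sumGraph {a} c G H) i j = sumAdj (adj G) (adj H) c (splitAt a i) (splitAt a j)
adj-sym (sumGraph {a} c G H) i j =
  sumAdj-sym (adj G) (adj H) c (adj-sym G) (adj-sym H) (splitAt a i) (splitAt a j)
adj-irr (sumGraph {a} c G H) i =
  sumAdj-irr (adj G) (adj H) c (adj-irr G) (adj-irr H) (splitAt a i)

_∪ᴳ_ : ∀ {a b} → Graph a → Graph b → Graph (a + b)
G ∪ᴳ H = sumGraph false G H

_∨ᴳ_ : ∀ {a b} → Graph a → Graph b → Graph (a + b)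
G ∨ᴳ H = sumGraph true G H

isPair : ∀ {n} → Fin n → Fin n → Fin n → Fin n → Bool
isPair x y i j = (does (i ≟ x) ∧ does (j ≟ y)) ∨ (does (i ≟ y) ∧ does (j ≟ x))

isPair-sym : ∀ {n} (x y i j : Fin n) → isPair x y i j ≡ isPair x y j i
isPair-sym x y i j
  rewrite ∧-comm (does (i ≟ x)) (does (j ≟ y))
        | ∧-comm (does (i ≟ y)) (does (j ≟ x)) =
  ∨-comm (does (j ≟ y) ∧ does (i ≟ x)) (does (j ≟ x) ∧ does (i ≟ y))

deleteEdge : ∀ {n} → Graph n → Fin n → Fin n → Graph n
adj (deleteEdge G x y) i j = adj G i j ∧ not (isPair x y i j)
adj-sym (deleteEdge G x y) i j rewrite adj-sym G i j | isPair-sym x y i j = refl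
adj-irr (deleteEdge G x y) i rewrite adj-irr G i = refl

_≅_ : ∀ {n m} → Graph n → Graph m → Set
_≅_ {n} {m} G H = Σ (Fin n ↔ Fin m) λ f →
  ∀ i j → adj G i j ≡ adj H (Inverse.to f i) (Inverse.to f j)

Base : (n δ : ℕ) → Graph (δ + (2 + (n ∸ δ ∸ 2)))
Base n δ = K δ ∨ᴳ (K 2 ∪ᴳ K (n ∸ δ ∸ 2))

Exceptional : ∀ {n} → Graph n → ℕ → Set
Exceptional {n} G δ = ∃ λ x → ∃ λ y →
  T (adj (Base n δ) x y) × deg (Base n δ) x ≡ suc δ × deg (Base n δ) y ≡ n ∸ 1 ×
  G ≅ deleteEdge (Base n δ) x y

-- Call an ordered pair of distinct non-adjacent vertices a non-edge.  Since
-- 2|E| ≥ (n−2)(n−3) + 4δ, G has at most 4n − 6 − 4δ non-edges.  A minimum vertex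
-- cut S has |S| ≤ δ, because the neighbourhood of a vertex w of minimum degree
-- separates w from its non-neighbours.  Let A be the component of G − S
-- containing a vertex separated from some v, and B the rest of G − S.  If A or B
-- is a single vertex, that vertex is isolated in G − S and has degree at most
-- |S| ≤ δ, as super-κ demands.
-- Otherwise the 2|A||B| pairs between A and B are non-edges, and so are the
-- n − 1 − δ pairs at w.  If w ∈ S this exceeds the bound.  If w ∈ A (B is
-- symmetric) the bound forces |A| = 2, |S| = δ, a unique non-neighbour y of w
-- outside B, and no further non-edges.  So either y ∈ A and w is isolated in
-- G − S, or y ∈ S and G is K_δ ∨ (K_2 ∪ K_{n−δ−2}) with the edge wy removed.

module Submission where

open import Defs
open import Data.Bool using (Bool; true; false; _∧_; _∨_; not; T; if_then_else_)
open import Data.Bool.Properties using (T?; T-∧; T-∨; T-≡; T-not-≡; ∧-identityʳ; ∧-zeroʳ; ∨-zeroʳ)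
open import Data.Nat using (ℕ; zero; suc; _+_; _*_; _∸_; _≤_; _<_; _<ᵇ_; _≤?_; _<?_; z≤n; s≤s)
open import Data.Nat.Properties hiding (_≟_)
open import Data.Nat.Combinatorics using (_C_; nCk+nC[k+1]≡[n+1]C[k+1]; nC1≡n)
open import Data.Nat.Tactic.RingSolver using (solve-∀)
open import Data.Fin using (Fin; zero; suc; _≟_; toℕ; punchIn; fromℕ<; _↑ˡ_; _↑ʳ_; splitAt)
open import Data.Fin.Properties
  using (toℕ-injective; any?; toℕ-fromℕ<; toℕ-↑ˡ; toℕ-↑ʳ; toℕ<n; splitAt-↑ˡ; splitAt-↑ʳ;
         splitAt⁻¹-↑ˡ; splitAt⁻¹-↑ʳ; ↑ˡ-injective; ↑ʳ-injective; toℕ-cast)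
open import Data.Fin.Subset using (Subset; _∈_; _∉_; ∣_∣)
open import Data.Fin.Permutation as Perm using (Permutation′; insert; _⟨$⟩ʳ_; _∘ₚ_; cast-id)
open import Data.Vec using ([]; _∷_; tabulate; lookup)
open import Data.Vec.Properties using ([]=⇒lookup; lookup⇒[]=; lookup∘tabulate)
import Data.List as List using (map; tabulate; allFin)
open import Data.List.Properties using (map-tabulate)
import Data.Nat.ListAction as ListAction
open import Data.Product using (Σ; ∃; _×_; _,_; proj₁; proj₂)
open import Data.Sum using (_⊎_; inj₁; inj₂; [_,_]′)
open import Data.Empty using (⊥; ⊥-elim)
open import Function using (_∘_; id)
open import Function.Bundles using (Equivalence; Inverse; Injection; _↔_)
open import Function.Properties.Inverse using (↔⇒↣)
open import Relation.Nullary using (Dec; does; yes; no; ¬_; contradiction)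
open import Relation.Nullary.Decidable using (isYes; toWitness; fromWitness)
open import Relation.Binary.Definitions using (DecidableEquality)
open import Relation.Binary.PropositionalEquality

open import Algebra.Properties.CommutativeMonoid.Sum +-0-commutativeMonoid
  using (sum; sum-cong-≗; ∑-distrib-+; ∑-comm; ∑-permute; sum-replicate-zero)
open import Algebra.Properties.Semiring.Sum +-*-semiring using (*-distribʳ-sum)

T-≟⇒≡ : ∀ {n} {i j : Fin n} → T (does (j ≟ i)) → j ≡ i
T-≟⇒≡ {i = i} {j} t with j ≟ i
... | yes j≡i = j≡i

does-≟-refl : ∀ {n} (i : Fin n) → does (i ≟ i) ≡ true
does-≟-refl i = cong does (≡-≟-identity _≟_ {i} refl)

does-≢ : ∀ {n} {i j : Fin n} → i ≢ j → does (i ≟ j) ≡ false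
does-≢ {i = i} {j} i≢j with i ≟ j
... | yes i≡j = contradiction i≡j i≢j
... | no  _   = refl

does-≟-injective : ∀ {m n} {f : Fin m → Fin n} → (∀ {a b} → f a ≡ f b → a ≡ b) →
                   ∀ a b → does (f a ≟ f b) ≡ does (a ≟ b)
does-≟-injective {f = f} injective a b with a ≟ b | f a ≟ f b
... | yes refl | yes _   = refl
... | yes refl | no  fa≢fa = contradiction refl fa≢fa
... | no  a≢b  | yes fa≡fb = contradiction (injective fa≡fb) a≢b
... | no  _    | no  _   = refl

does-≟-↔ : ∀ {m n} (φ : Fin m ↔ Fin n) a b →
           does (Inverse.to φ a ≟ Inverse.to φ b) ≡ does (a ≟ b)
does-≟-↔ φ = does-≟-injective (Injection.injective (↔⇒↣ φ))

¬T⇒≡false : ∀ {b} → ¬ T b → b ≡ false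
¬T⇒≡false {false} _  = refl
¬T⇒≡false {true}  ¬t = contradiction _ ¬t

∉⇒lookup : ∀ {n} {S : Subset n} {z} → z ∉ S → lookup S z ≡ false
∉⇒lookup {S = S} {z} z∉S with lookup S z in Sz
... | false = refl
... | true  = contradiction (lookup⇒[]= z S Sz) z∉S

lookup⇒∉ : ∀ {n} {S : Subset n} {z} → lookup S z ≡ false → z ∉ S
lookup⇒∉ Sz z∈S with trans (sym ([]=⇒lookup z∈S)) Sz
... | ()

𝟙 : Bool → ℕ
𝟙 true  = 1
𝟙 false = 0

count : ∀ {n} → (Fin n → Bool) → ℕ
count f = sum (𝟙 ∘ f)

sum-mono-≤ : ∀ {n} {f g : Fin n → ℕ} → (∀ i → f i ≤ g i) → sum f ≤ sum g
sum-mono-≤ {zero}  f≤g = z≤n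
sum-mono-≤ {suc n} f≤g = +-mono-≤ (f≤g zero) (sum-mono-≤ (f≤g ∘ suc))

sum-≤-tight : ∀ {n} {f g : Fin n → ℕ} → (∀ i → f i ≤ g i) → sum g ≤ sum f →
              ∀ i → g i ≤ f i
sum-≤-tight {suc n} {f} {g} f≤g ∑g≤∑f zero = +-cancelʳ-≤ (sum (f ∘ suc)) _ _
  (≤-trans (+-monoʳ-≤ (g zero) (sum-mono-≤ (f≤g ∘ suc))) ∑g≤∑f)
sum-≤-tight {suc n} {f} {g} f≤g ∑g≤∑f (suc i) = sum-≤-tight (f≤g ∘ suc)
  (+-cancelˡ-≤ (g zero) _ _ (≤-trans ∑g≤∑f (+-monoˡ-≤ _ (f≤g zero)))) i

𝟙-mono : ∀ {a b} → (T a → T b) → 𝟙 a ≤ 𝟙 b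
𝟙-mono {false}        _   = z≤n
𝟙-mono {true} {true}  _   = ≤-refl
𝟙-mono {true} {false} a⇒b = ⊥-elim (a⇒b _)

count-mono : ∀ {n} {f g : Fin n → Bool} → (∀ i → T (f i) → T (g i)) → count f ≤ count g
count-mono f⊆g = sum-mono-≤ (λ i → 𝟙-mono (f⊆g i))

count-⊆-tight : ∀ {n} {f g : Fin n → Bool} → (∀ i → T (f i) → T (g i)) →
                count g ≤ count f → ∀ i → T (g i) → T (f i)
count-⊆-tight {f = f} {g} f⊆g ∣g∣≤∣f∣ i gi
  with f i | g i | sum-≤-tight (λ j → 𝟙-mono (f⊆g j)) ∣g∣≤∣f∣ i
... | true  | _     | _  = _
... | false | true  | ()
count-⊆-tight f⊆g ∣g∣≤∣f∣ i () | false | false | _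

count≤n : ∀ {n} (f : Fin n → Bool) → count f ≤ n
count≤n {zero}  f = z≤n
count≤n {suc n} f = +-mono-≤ (𝟙-mono {b = true} _) (count≤n (f ∘ suc))

count-singleton : ∀ {n} (i : Fin n) → count (λ j → does (j ≟ i)) ≡ 1
count-singleton {suc n} zero    = cong suc (sum-replicate-zero n)
count-singleton {suc n} (suc i) = count-singleton i

count-∧ˡ : ∀ {n} b (f : Fin n → Bool) → count (λ j → b ∧ f j) ≡ 𝟙 b * count f
count-∧ˡ     true  f = sym (+-identityʳ (count f))
count-∧ˡ {n} false f = sum-replicate-zero n

count-∨-disjoint : ∀ {n} (f g : Fin n → Bool) → (∀ i → T (f i) → T (g i) → ⊥) →
                   count (λ i → f i ∨ g i) ≡ count f + count g
count-∨-disjoint f g disj =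
  trans (sum-cong-≗ (λ i → 𝟙-∨ (f i) (g i) (disj i))) (∑-distrib-+ (𝟙 ∘ f) (𝟙 ∘ g))
  where
  𝟙-∨ : ∀ a b → (T a → T b → ⊥) → 𝟙 (a ∨ b) ≡ 𝟙 a + 𝟙 b
  𝟙-∨ true  true  disj = ⊥-elim (disj _ _)
  𝟙-∨ true  false _    = refl
  𝟙-∨ false b     _    = refl

singleton⊆ : ∀ {n} {f : Fin n → Bool} {i} → T (f i) → ∀ j → T (does (j ≟ i)) → T (f j)
singleton⊆ {f = f} fi j j≡i = subst (T ∘ f) (sym (T-≟⇒≡ j≡i)) fi

1≤count : ∀ {n} {f : Fin n → Bool} {i} → T (f i) → 1 ≤ count f
1≤count {f = f} {i} fi = subst (_≤ count f) (count-singleton i) (count-mono (singleton⊆ {f = f} fi))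

count≤1⇒unique : ∀ {n} {f : Fin n → Bool} {i j} → count f ≤ 1 → T (f i) → T (f j) → j ≡ i
count≤1⇒unique {f = f} {i} {j} ∣f∣≤1 fi fj =
  T-≟⇒≡ (count-⊆-tight (singleton⊆ {f = f} fi)
           (subst (count f ≤_) (sym (count-singleton i)) ∣f∣≤1) j fj)

count≤2⇒pair : ∀ {n} {f : Fin n → Bool} {a b k} → count f ≤ 2 → T (f a) → T (f b) → a ≢ b →
                T (f k) → k ≡ a ⊎ k ≡ b
count≤2⇒pair {f = f} {a} {b} {k} ∣f∣≤2 fa fb a≢b fk
  with count-⊆-tight {f = λ j → does (j ≟ a) ∨ does (j ≟ b)} {g = f} pair⊆f
         (subst (count f ≤_) (sym ∣pair∣≡2) ∣f∣≤2) k fk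
  where
  pair⊆f : ∀ j → T (does (j ≟ a) ∨ does (j ≟ b)) → T (f j)
  pair⊆f j t with j ≟ a | j ≟ b
  ... | yes refl | _        = fa
  ... | no  _    | yes refl = fb
  ∣pair∣≡2 : count (λ j → does (j ≟ a) ∨ does (j ≟ b)) ≡ 2
  ∣pair∣≡2 = trans (count-∨-disjoint _ _ disj) (cong₂ _+_ (count-singleton a) (count-singleton b))
    where
    disj : ∀ j → T (does (j ≟ a)) → T (does (j ≟ b)) → ⊥
    disj j j≡a j≡b = a≢b (trans (sym (T-≟⇒≡ {j = j} j≡a)) (T-≟⇒≡ {j = j} j≡b))
... | k∈pair with k ≟ a | k ≟ b
...   | yes k≡a | _       = inj₁ k≡a
...   | no  _   | yes k≡b = inj₂ k≡b

1≤count⇒∃ : ∀ {n} (f : Fin n → Bool) → 1 ≤ count f → ∃ λ i → T (f i)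
1≤count⇒∃ {suc n} f 1≤∣f∣ with f zero in f0
... | true  = zero , subst T (sym f0) _
... | false with 1≤count⇒∃ (f ∘ suc) 1≤∣f∣
...   | i , fi = suc i , fi

count-tabulate : ∀ {n} (f : Fin n → Bool) → ∣ tabulate f ∣ ≡ count f
count-tabulate {zero}  f = refl
count-tabulate {suc n} f with f zero
... | true  = cong suc (count-tabulate (f ∘ suc))
... | false = count-tabulate (f ∘ suc)

count-lookup : ∀ {n} (S : Subset n) → ∣ S ∣ ≡ count (lookup S)
count-lookup []          = refl
count-lookup (true  ∷ S) = cong suc (count-lookup S)
count-lookup (false ∷ S) = count-lookup S

sum-const : ∀ {n} k → sum {n} (λ _ → k) ≡ n * k
sum-const {zero}  k = refl
sum-const {suc n} k = cong (k +_) (sum-const {n} k)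

count-true : ∀ {n} → count {n} (λ _ → true) ≡ n
count-true {zero}  = refl
count-true {suc n} = cong suc (count-true {n})

sum-bump : ∀ {n} (f : Fin n → ℕ) w c → sum (λ i → f i + 𝟙 (does (i ≟ w)) * c) ≡ sum f + c
sum-bump {n} f w c = begin
  sum (λ i → f i + 𝟙 (w≡ i) * c)    ≡⟨ ∑-distrib-+ f (λ i → 𝟙 (w≡ i) * c) ⟩
  sum f + sum (λ i → 𝟙 (w≡ i) * c)  ≡⟨ cong (sum f +_) (*-distribʳ-sum c (𝟙 ∘ w≡)) ⟨
  sum f + count w≡ * c              ≡⟨ cong (λ k → sum f + k * c) (count-singleton w) ⟩
  sum f + 1 * c                     ≡⟨ cong (sum f +_) (*-identityˡ c) ⟩
  sum f + c                         ∎
  where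
  open ≡-Reasoning
  w≡ : Fin n → Bool
  w≡ i = does (i ≟ w)

-- Non-adjacency and the edge count

nonadj : ∀ {n} → Graph n → Fin n → Fin n → Bool
nonadj G i j = not (adj G i j) ∧ not (does (j ≟ i))

codeg : ∀ {n} → Graph n → Fin n → ℕ
codeg G i = count (nonadj G i)





nonadj-intro : ∀ {n} {G : Graph n} {i j} → adj G i j ≡ false → j ≢ i → T (nonadj G i j)
nonadj-intro {i = i} {j} ij j≢i rewrite ij with j ≟ i
... | yes j≡i = contradiction j≡i j≢i
... | no  _   = _

nonadj⇒¬adj : ∀ {n} {G : Graph n} {i j} → T (nonadj G i j) → adj G i j ≡ false
nonadj⇒¬adj {G = G} {i} {j} t = Equivalence.to T-not-≡ (proj₁ (Equivalence.to T-∧ t))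

nonadj⇒≢ : ∀ {n} {G : Graph n} {i j} → T (nonadj G i j) → j ≢ i
nonadj⇒≢ {G = G} {i} {j} t refl with j ≟ j | proj₂ (Equivalence.to (T-∧ {not (adj G j j)}) t)
... | yes _   | ()
... | no  j≢j | _ = j≢j refl

nonadj-sym : ∀ {n} {G : Graph n} {i j} → T (nonadj G i j) → T (nonadj G j i)
nonadj-sym {G = G} {i} {j} t =
  nonadj-intro {G = G} (trans (adj-sym G j i) (nonadj⇒¬adj {G = G} t))
               (λ i≡j → nonadj⇒≢ {G = G} t (sym i≡j))

isPair-refl : ∀ {n} (x y : Fin n) → isPair x y x y ≡ true
isPair-refl x y with x ≟ x | y ≟ y
... | yes _ | yes _ = refl
... | no x≢x | _ = contradiction refl x≢x
... | yes _ | no y≢y = contradiction refl y≢y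

isPair-swap : ∀ {n} (x y : Fin n) → isPair x y y x ≡ true
isPair-swap x y with y ≟ y | x ≟ x
... | yes _ | yes _ = ∨-zeroʳ _
... | no y≢y | _ = contradiction refl y≢y
... | yes _ | no x≢x = contradiction refl x≢x

isPair-elim : ∀ {n} {x y i j : Fin n} → T (isPair x y i j) → (i ≡ x × j ≡ y) ⊎ (i ≡ y × j ≡ x)
isPair-elim {x = x} {y} {i} {j} t with Equivalence.to (T-∨ {does (i ≟ x) ∧ does (j ≟ y)}) t
... | inj₁ ij≡xy with Equivalence.to (T-∧ {does (i ≟ x)}) ij≡xy
...   | i≡x , j≡y = inj₁ (T-≟⇒≡ i≡x , T-≟⇒≡ j≡y)
isPair-elim {x = x} {y} {i} {j} t | inj₂ ij≡yx with Equivalence.to (T-∧ {does (i ≟ y)}) ij≡yx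
...   | i≡y , j≡x = inj₂ (T-≟⇒≡ i≡y , T-≟⇒≡ j≡x)

deg+codeg : ∀ {n} (G : Graph n) i → deg G i + codeg G i + 1 ≡ n
deg+codeg {n} G i = begin
  deg G i + codeg G i + 1
    ≡⟨ cong₂ (λ a b → a + codeg G i + b) (count-tabulate (adj G i)) (sym (count-singleton i)) ⟩
  count (adj G i) + codeg G i + count (λ j → does (j ≟ i))
    ≡⟨ cong (_+ count (λ j → does (j ≟ i))) (∑-distrib-+ (𝟙 ∘ adj G i) (𝟙 ∘ nonadj G i)) ⟨
  sum (λ j → 𝟙 (adj G i j) + 𝟙 (nonadj G i j)) + count (λ j → does (j ≟ i))
    ≡⟨ ∑-distrib-+ (λ j → 𝟙 (adj G i j) + 𝟙 (nonadj G i j)) (λ j → 𝟙 (does (j ≟ i))) ⟨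
  sum (λ j → 𝟙 (adj G i j) + 𝟙 (nonadj G i j) + 𝟙 (does (j ≟ i)))
    ≡⟨ sum-cong-≗ exactlyOne ⟩
  count {n} (λ _ → true)
    ≡⟨ count-true ⟩
  n ∎
  where
  open ≡-Reasoning
  exactlyOne : ∀ j → 𝟙 (adj G i j) + 𝟙 (nonadj G i j) + 𝟙 (does (j ≟ i)) ≡ 1
  exactlyOne j with j ≟ i
  ... | yes refl rewrite adj-irr G j = refl
  ... | no _ with adj G i j
  ...   | true  = refl
  ...   | false = refl

upper : ∀ {n} → Graph n → Fin n → Fin n → Bool
upper G i j = adj G i j ∧ (toℕ i <ᵇ toℕ j)

size≡ : ∀ {n} (G : Graph n) → size G ≡ sum (λ i → count (upper G i))
size≡ {n} G = begin
  ListAction.sum (List.map row (List.allFin n))  ≡⟨ cong ListAction.sum (map-tabulate id row) ⟩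
  ListAction.sum (List.tabulate row)             ≡⟨ sum-tabulate row ⟩
  sum row                                  ≡⟨ sum-cong-≗ (λ i → count-tabulate (upper G i)) ⟩
  sum (λ i → count (upper G i))            ∎
  where
  open ≡-Reasoning
  row : Fin n → ℕ
  row i = ∣ tabulate (upper G i) ∣
  sum-tabulate : ∀ {k} (f : Fin k → ℕ) → ListAction.sum (List.tabulate f) ≡ sum f
  sum-tabulate {zero}  f = refl
  sum-tabulate {suc k} f = cong (f zero +_) (sum-tabulate (f ∘ suc))

handshake : ∀ {n} (G : Graph n) → sum (deg G) ≡ size G + size G
handshake {n} G = begin
  sum (deg G)
    ≡⟨ sum-cong-≗ (λ i → trans (count-tabulate (adj G i)) (sum-cong-≗ (split i))) ⟩
  sum (λ i → sum (λ j → 𝟙 (upper G i j) + 𝟙 (upper G j i)))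
    ≡⟨ sum-cong-≗ (λ i → ∑-distrib-+ (𝟙 ∘ upper G i) (λ j → 𝟙 (upper G j i))) ⟩
  sum (λ i → count (upper G i) + sum (λ j → 𝟙 (upper G j i)))
    ≡⟨ ∑-distrib-+ (λ i → count (upper G i)) (λ i → sum (λ j → 𝟙 (upper G j i))) ⟩
  sum (λ i → count (upper G i)) + sum (λ i → sum (λ j → 𝟙 (upper G j i)))
    ≡⟨ cong (sum (λ i → count (upper G i)) +_) (∑-comm (λ i j → 𝟙 (upper G j i))) ⟩
  sum (λ i → count (upper G i)) + sum (λ j → count (upper G j))
    ≡⟨ cong₂ _+_ (size≡ G) (size≡ G) ⟨
  size G + size G ∎
  where
  open ≡-Reasoning
  oneOrder : ∀ {a b} → a ≢ b → 𝟙 (a <ᵇ b) + 𝟙 (b <ᵇ a) ≡ 1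
  oneOrder {a} {b} a≢b with a <ᵇ b in a<b | b <ᵇ a in b<a
  ... | true  | false = refl
  ... | false | true  = refl
  ... | true  | true  = ⊥-elim (<-asym (<ᵇ⇒< a b (subst T (sym a<b) _)) (<ᵇ⇒< b a (subst T (sym b<a) _)))
  ... | false | false = ⊥-elim (a≢b (≤-antisym (≮⇒≥ λ b<a′ → subst T b<a (<⇒<ᵇ b<a′))
                                               (≮⇒≥ λ a<b′ → subst T a<b (<⇒<ᵇ a<b′))))
  split : ∀ i j → 𝟙 (adj G i j) ≡ 𝟙 (upper G i j) + 𝟙 (upper G j i)
  split i j with i ≟ j
  ... | yes refl rewrite adj-irr G i = refl
  ... | no i≢j rewrite adj-sym G j i with adj G i j
  ...   | true  = sym (oneOrder (i≢j ∘ toℕ-injective))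
  ...   | false = refl

sum-deg+codeg : ∀ {n} (G : Graph n) → sum (deg G) + sum (codeg G) + n ≡ n * n
sum-deg+codeg {n} G = begin
  sum (deg G) + sum (codeg G) + n
    ≡⟨ cong₂ _+_ (∑-distrib-+ (deg G) (codeg G)) count-true ⟨
  sum (λ i → deg G i + codeg G i) + sum {n} (λ _ → 1)
    ≡⟨ ∑-distrib-+ (λ i → deg G i + codeg G i) (λ _ → 1) ⟨
  sum (λ i → deg G i + codeg G i + 1) ≡⟨ sum-cong-≗ (deg+codeg G) ⟩
  sum {n} (λ _ → n)                   ≡⟨ sum-const {n} n ⟩
  n * n                               ∎
  where open ≡-Reasoning

nC2+nC2+n≡n*n : ∀ n → n C 2 + n C 2 + n ≡ n * n
nC2+nC2+n≡n*n zero    = refl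
nC2+nC2+n≡n*n (suc n) = begin
  suc n C 2 + suc n C 2 + suc n             ≡⟨ cong (λ c → c + c + suc n) (nCk+nC[k+1]≡[n+1]C[k+1] n 1) ⟨
  (n C 1 + n C 2) + (n C 1 + n C 2) + suc n ≡⟨ cong (λ c → (c + n C 2) + (c + n C 2) + suc n) (nC1≡n n) ⟩
  (n + n C 2) + (n + n C 2) + suc n         ≡⟨ regroup n (n C 2) ⟩
  (n C 2 + n C 2 + n) + suc (n + n)         ≡⟨ cong (_+ suc (n + n)) (nC2+nC2+n≡n*n n) ⟩
  n * n + suc (n + n)                       ≡⟨ square n ⟩
  suc n * suc n                             ∎
  where
  open ≡-Reasoning
  regroup : ∀ n c → (n + c) + (n + c) + suc n ≡ (c + c + n) + suc (n + n)
  regroup = solve-∀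
  square : ∀ n → n * n + suc (n + n) ≡ suc n * suc n
  square = solve-∀

codeg-sum-bound : ∀ m (G : Graph (2 + m)) δ → m C 2 + 2 * δ ≤ size G →
                  sum (codeg G) + 4 * δ + 6 ≤ 4 * (2 + m)
codeg-sum-bound m G δ bound = +-cancelˡ-≤ (m * m + m + 2) _ _ (begin
  m * m + m + 2 + (N + 4 * δ + 6)
    ≡⟨ cong (λ x → x + m + 2 + (N + 4 * δ + 6)) (nC2+nC2+n≡n*n m) ⟨
  c + c + m + m + 2 + (N + 4 * δ + 6)               ≡⟨ regroup c m N δ ⟩
  (c + 2 * δ) + (c + 2 * δ) + N + (2 + m) + (m + 6)
    ≤⟨ +-monoˡ-≤ _ (+-monoˡ-≤ _ (+-monoˡ-≤ N (+-mono-≤ bound bound))) ⟩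
  size G + size G + N + (2 + m) + (m + 6)           ≡⟨ cong (λ d → d + N + (2 + m) + (m + 6)) (handshake G) ⟨
  sum (deg G) + N + (2 + m) + (m + 6)               ≡⟨ cong (_+ (m + 6)) (sum-deg+codeg G) ⟩
  (2 + m) * (2 + m) + (m + 6)                       ≡⟨ expand m ⟩
  m * m + m + 2 + 4 * (2 + m)                       ∎)
  where
  open ≤-Reasoning
  N c : ℕ
  N = sum (codeg G)
  c = m C 2
  regroup : ∀ c m N δ → c + c + m + m + 2 + (N + 4 * δ + 6) ≡
                        (c + 2 * δ) + (c + 2 * δ) + N + (2 + m) + (m + 6)
  regroup = solve-∀
  expand : ∀ m → (2 + m) * (2 + m) + (m + 6) ≡ m * m + m + 2 + 4 * (2 + m)
  expand = solve-∀

-- Vertex cuts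

codeg-antitone : ∀ {n} (G : Graph n) {u w} → deg G w ≤ deg G u → codeg G u ≤ codeg G w
codeg-antitone G {u} {w} dw≤du = +-cancelˡ-≤ (deg G w) _ _ (+-cancelʳ-≤ 1 _ _ (begin
  deg G w + codeg G u + 1 ≤⟨ +-monoˡ-≤ 1 (+-monoˡ-≤ (codeg G u) dw≤du) ⟩
  deg G u + codeg G u + 1 ≡⟨ trans (deg+codeg G u) (sym (deg+codeg G w)) ⟩
  deg G w + codeg G w + 1 ∎))
  where open ≤-Reasoning

neighbourhood-cut : ∀ {n} (G : Graph n) {w v} → T (nonadj G w v) → IsVertexCut G (tabulate (adj G w))
neighbourhood-cut G {w} {v} wv =
  w , v , outside (adj-irr G w) , outside (nonadj⇒¬adj {G = G} wv) , noPath
  where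
  outside : ∀ {z} → adj G w z ≡ false → z ∉ tabulate (adj G w)
  outside {z} wz = lookup⇒∉ (trans (lookup∘tabulate (adj G w) z) wz)
  noPath : ¬ PathAvoid G (tabulate (adj G w)) w v
  noPath here                  = nonadj⇒≢ {G = G} wv refl
  noPath (step {w = z} wz z∉N _) =
    z∉N (lookup⇒[]= z _ (trans (lookup∘tabulate (adj G w) z) (Equivalence.to T-≡ wz)))

minVertexCut≤minDegree : ∀ {n} (G : Graph n) {δ w} → deg G w ≡ δ → (∀ v → δ ≤ deg G v) →
                         ∀ S → IsMinVertexCut G S → ∣ S ∣ ≤ δ
minVertexCut≤minDegree G {δ} {w} dw minDeg S ((u , v , u∉S , v∉S , ¬u⇝v) , minimal) = begin
  ∣ S ∣                    ≤⟨ minimal _ (neighbourhood-cut G (proj₂ nonNeighbour)) ⟩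
  ∣ tabulate (adj G w) ∣   ≡⟨ dw ⟩
  δ                        ∎
  where
  open ≤-Reasoning
  noEdge : adj G u v ≡ false
  noEdge with adj G u v in uv
  ... | false = refl
  ... | true  = contradiction (step (subst T (sym uv) _) v∉S here) ¬u⇝v
  u≁v : T (nonadj G u v)
  u≁v = nonadj-intro {G = G} noEdge (λ v≡u → ¬u⇝v (subst (PathAvoid G S u) (sym v≡u) here))
  nonNeighbour : ∃ λ z → T (nonadj G w z)
  nonNeighbour = 1≤count⇒∃ (nonadj G w)
    (≤-trans (1≤count {f = nonadj G u} u≁v) (codeg-antitone G (subst (_≤ deg G u) (sym dw) (minDeg u))))

data Side : Set where
  cut left right : Side

_≟ˢ_ : DecidableEquality Side
cut   ≟ˢ cut   = yes refl
cut   ≟ˢ left  = no λ ()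
cut   ≟ˢ right = no λ ()
left  ≟ˢ cut   = no λ ()
left  ≟ˢ left  = yes refl
left  ≟ˢ right = no λ ()
right ≟ˢ cut   = no λ ()
right ≟ˢ left  = no λ ()
right ≟ˢ right = yes refl

infix 10 _⁻¹_
_⁻¹_ : ∀ {n} → (Fin n → Side) → Side → Fin n → Bool
(σ ⁻¹ c) i = does (σ i ≟ˢ c)

≡⇒T⁻¹ : ∀ {n} {σ : Fin n → Side} {i c} → σ i ≡ c → T ((σ ⁻¹ c) i)
≡⇒T⁻¹ {σ = σ} {i} {c} σi with σ i ≟ˢ c
... | yes _    = _
... | no  σi≢c = contradiction σi σi≢c

T⁻¹⇒≡ : ∀ {n} {σ : Fin n → Side} {i c} → T ((σ ⁻¹ c) i) → σ i ≡ c
T⁻¹⇒≡ {σ = σ} {i} {c} t with σ i ≟ˢ c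
... | yes σi≡c = σi≡c

opposite : Side → Side → Bool
opposite left  right = true
opposite right left  = true
opposite _     _     = false

opposite-sym : ∀ a b → opposite a b ≡ opposite b a
opposite-sym cut   cut   = refl
opposite-sym cut   left  = refl
opposite-sym cut   right = refl
opposite-sym left  cut   = refl
opposite-sym left  left  = refl
opposite-sym left  right = refl
opposite-sym right cut   = refl
opposite-sym right left  = refl
opposite-sym right right = refl

opposite-irr : ∀ a → opposite a a ≡ false
opposite-irr cut   = refl
opposite-irr left  = refl
opposite-irr right = refl

T-opposite⇒≢ : ∀ {a b} → T (opposite a b) → a ≢ b
T-opposite⇒≢ {a} opp refl rewrite opposite-irr a = opp

noncut-opposite : ∀ {a b} → a ≢ cut → b ≢ cut → a ≢ b → T (opposite a b)
noncut-opposite {cut}   a≢cut _     _   = contradiction refl a≢cut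
noncut-opposite {left}  {cut}   _ b≢cut _ = contradiction refl b≢cut
noncut-opposite {left}  {left}  _ _ a≢b = contradiction refl a≢b
noncut-opposite {left}  {right} _ _ _   = _
noncut-opposite {right} {cut}   _ b≢cut _ = contradiction refl b≢cut
noncut-opposite {right} {left}  _ _ _   = _
noncut-opposite {right} {right} _ _ a≢b = contradiction refl a≢b

opposite-left⇒right : ∀ {a} → T (opposite a left) → a ≡ right
opposite-left⇒right {right} _ = refl

Separates : ∀ {n} → Graph n → (Fin n → Side) → Set
Separates G σ = ∀ i j → T (opposite (σ i) (σ j)) → adj G i j ≡ false

-- K_{|cut|} ∨ (K_{|left|} ∪ K_{|right|}), with its vertices labelled by σ.
sideGraph : ∀ {n} → (Fin n → Side) → Graph n
adj     (sideGraph {n} σ) i j = adj (K n) i j ∧ not (opposite (σ i) (σ j))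
adj-sym (sideGraph {n} σ) i j =
  cong₂ (λ a b → a ∧ not b) (adj-sym (K n) i j) (opposite-sym (σ i) (σ j))
adj-irr (sideGraph {n} σ) i = cong (_∧ _) (adj-irr (K n) i)

sum-by-side : ∀ {n} (σ : Fin n → Side) (f : Side → ℕ) → sum (f ∘ σ) ≡
  count (σ ⁻¹ cut) * f cut + count (σ ⁻¹ left) * f left + count (σ ⁻¹ right) * f right
sum-by-side {n} σ f = begin
  sum (f ∘ σ)
    ≡⟨ sum-cong-≗ (λ i → split (σ i)) ⟩
  sum (λ i → part cut i + part left i + part right i)
    ≡⟨ ∑-distrib-+ (λ i → part cut i + part left i) (part right) ⟩
  sum (λ i → part cut i + part left i) + sum (part right)
    ≡⟨ cong (_+ sum (part right)) (∑-distrib-+ (part cut) (part left)) ⟩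
  sum (part cut) + sum (part left) + sum (part right)
    ≡⟨ cong₂ _+_ (cong₂ _+_ (scale cut) (scale left)) (scale right) ⟩
  count (σ ⁻¹ cut) * f cut + count (σ ⁻¹ left) * f left + count (σ ⁻¹ right) * f right ∎
  where
  open ≡-Reasoning
  part : Side → Fin n → ℕ
  part c i = 𝟙 ((σ ⁻¹ c) i) * f c
  scale : ∀ c → sum (part c) ≡ count (σ ⁻¹ c) * f c
  scale c = sym (*-distribʳ-sum (f c) (𝟙 ∘ σ ⁻¹ c))
  pick₁ : ∀ x y z → x ≡ 1 * x + 0 * y + 0 * z
  pick₁ = solve-∀
  pick₂ : ∀ x y z → y ≡ 0 * x + 1 * y + 0 * z
  pick₂ = solve-∀
  pick₃ : ∀ x y z → z ≡ 0 * x + 0 * y + 1 * z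
  pick₃ = solve-∀
  split : ∀ c → f c ≡ 𝟙 (does (c ≟ˢ cut)) * f cut + 𝟙 (does (c ≟ˢ left)) * f left
                      + 𝟙 (does (c ≟ˢ right)) * f right
  split cut   = pick₁ (f cut) (f left) (f right)
  split left  = pick₂ (f cut) (f left) (f right)
  split right = pick₃ (f cut) (f left) (f right)

count-sides : ∀ {n} (σ : Fin n → Side) →
              count (σ ⁻¹ cut) + count (σ ⁻¹ left) + count (σ ⁻¹ right) ≡ n
count-sides {n} σ = begin
  count (σ ⁻¹ cut) + count (σ ⁻¹ left) + count (σ ⁻¹ right)
    ≡⟨ cong₂ _+_ (cong₂ _+_ (*-identityʳ (count (σ ⁻¹ cut))) (*-identityʳ (count (σ ⁻¹ left))))
                 (*-identityʳ (count (σ ⁻¹ right))) ⟨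
  count (σ ⁻¹ cut) * 1 + count (σ ⁻¹ left) * 1 + count (σ ⁻¹ right) * 1
    ≡⟨ sum-by-side σ (λ _ → 1) ⟨
  count {n} (λ _ → true)
    ≡⟨ count-true ⟩
  n ∎
  where open ≡-Reasoning

across : ∀ {n} → (Fin n → Side) → Side → ℕ
across σ cut   = 0
across σ left  = count (σ ⁻¹ right)
across σ right = count (σ ⁻¹ left)

count-opposite : ∀ {n} (σ : Fin n → Side) c → count (λ j → opposite c (σ j)) ≡ across σ c
count-opposite {n} σ cut   = sum-replicate-zero n
count-opposite     σ left  = sum-cong-≗ (λ j → cong 𝟙 (opposite-left (σ j)))
  where
  opposite-left : ∀ c → opposite left c ≡ does (c ≟ˢ right)
  opposite-left cut   = refl
  opposite-left left  = refl
  opposite-left right = refl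
count-opposite     σ right = sum-cong-≗ (λ j → cong 𝟙 (opposite-right (σ j)))
  where
  opposite-right : ∀ c → opposite right c ≡ does (c ≟ˢ left)
  opposite-right cut   = refl
  opposite-right left  = refl
  opposite-right right = refl

nonadj-sideGraph : ∀ {n} (σ : Fin n → Side) i j → nonadj (sideGraph σ) i j ≡ opposite (σ i) (σ j)
nonadj-sideGraph σ i j with i ≟ j | j ≟ i
... | yes refl | yes _    = sym (opposite-irr (σ i))
... | yes refl | no  i≢i  = contradiction refl i≢i
... | no  i≢j  | yes refl = contradiction refl i≢j
... | no  _    | no  _    with opposite (σ i) (σ j)
...   | true  = refl
...   | false = refl

codeg-sideGraph : ∀ {n} (σ : Fin n → Side) i → codeg (sideGraph σ) i ≡ across σ (σ i)
codeg-sideGraph σ i =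
  trans (sum-cong-≗ (cong 𝟙 ∘ nonadj-sideGraph σ i)) (count-opposite σ (σ i))

deg-sideGraph : ∀ {n} (σ : Fin n → Side) i → deg (sideGraph σ) i + across σ (σ i) + 1 ≡ n
deg-sideGraph σ i =
  trans (cong (λ c → deg (sideGraph σ) i + c + 1) (sym (codeg-sideGraph σ i))) (deg+codeg (sideGraph σ) i)

mirror : Side → Side
mirror cut   = cut
mirror left  = right
mirror right = left

mirror-opposite : ∀ a b → opposite (mirror a) (mirror b) ≡ opposite a b
mirror-opposite cut   cut   = refl
mirror-opposite cut   left  = refl
mirror-opposite cut   right = refl
mirror-opposite left  cut   = refl
mirror-opposite left  left  = refl
mirror-opposite left  right = refl
mirror-opposite right cut   = refl
mirror-opposite right left  = refl
mirror-opposite right right = refl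

mirror≡cut : ∀ {a} → mirror a ≡ cut → a ≡ cut
mirror≡cut {cut} _ = refl

count-mirror : ∀ {n} (σ : Fin n → Side) c → count ((mirror ∘ σ) ⁻¹ c) ≡ count (σ ⁻¹ mirror c)
count-mirror σ c = sum-cong-≗ (λ i → cong 𝟙 (mirror-≟ (σ i) c))
  where
  mirror-≟ : ∀ a c → does (mirror a ≟ˢ c) ≡ does (a ≟ˢ mirror c)
  mirror-≟ cut   cut   = refl
  mirror-≟ cut   left  = refl
  mirror-≟ cut   right = refl
  mirror-≟ left  cut   = refl
  mirror-≟ left  left  = refl
  mirror-≟ left  right = refl
  mirror-≟ right cut   = refl
  mirror-≟ right left  = refl
  mirror-≟ right right = refl

separates-mirror : ∀ {n} {G : Graph n} {σ} → Separates G σ → Separates G (mirror ∘ σ)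
separates-mirror {σ = σ} sep i j opp = sep i j (subst T (mirror-opposite (σ i) (σ j)) opp)

separates-by-left-right : ∀ {n} {G : Graph n} (σ : Fin n → Side) →
  (∀ i j → σ i ≡ left → σ j ≡ right → adj G i j ≡ false) → Separates G σ
separates-by-left-right {G = G} σ noEdge i j opp with σ i in σi | σ j in σj
separates-by-left-right σ noEdge i j opp | left  | right = noEdge i j σi σj
separates-by-left-right {G = G} σ noEdge i j opp | right | left = trans (adj-sym G i j) (noEdge j i σj σi)
separates-by-left-right σ noEdge i j () | cut   | _
separates-by-left-right σ noEdge i j () | left  | cut
separates-by-left-right σ noEdge i j () | left  | left
separates-by-left-right σ noEdge i j () | right | cut
separates-by-left-right σ noEdge i j () | right | right

-- The component of a vertex in G − S

path-snoc : ∀ {n} {G : Graph n} {S u y z} → PathAvoid G S u y → T (adj G y z) → z ∉ S →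
            PathAvoid G S u z
path-snoc here           yz z∉S = step yz z∉S here
path-snoc (step xw w∉S p) yz z∉S = step xw w∉S (path-snoc p yz z∉S)

module ComponentOf {n} (G : Graph n) (S : Subset n) (u : Fin n) (u∉S : u ∉ S) where

  reach : ℕ → Fin n → Bool
  reach zero    z = does (z ≟ u)
  reach (suc k) z = reach k z ∨ (not (lookup S z) ∧ isYes (any? λ y → T? (reach k y ∧ adj G y z)))

  reach-step : ∀ {k y z} → T (reach k y) → T (adj G y z) → lookup S z ≡ false →
               T (reach (suc k) z)
  reach-step {k} {y} {z} ky yz Sz rewrite Sz with reach k z
  ... | true  = _
  ... | false = fromWitness (y , Equivalence.from T-∧ (ky , yz))

  reach-mono : ∀ k z → T (reach k z) → T (reach (suc k) z)
  reach-mono k z kz with reach k z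
  ... | true = _

  reach-suc : ∀ k z → T (reach (suc k) z) →
              T (reach k z) ⊎ (lookup S z ≡ false × ∃ λ y → T (reach k y) × T (adj G y z))
  reach-suc k z t with reach k z | lookup S z
  ... | true  | _     = inj₁ _
  ... | false | false with toWitness t
  ...   | y , ky∧yz = inj₂ (refl , y , Equivalence.to T-∧ ky∧yz)

  reach-path : ∀ k z → T (reach k z) → PathAvoid G S u z
  reach-path zero z t with z ≟ u
  ... | yes refl = here
  reach-path (suc k) z t with reach-suc k z t
  ... | inj₁ kz                = reach-path k z kz
  ... | inj₂ (Sz , y , ky , yz) = path-snoc (reach-path k y ky) yz (lookup⇒∉ Sz)

  Stable : ℕ → Set
  Stable k = ∀ z → T (reach (suc k) z) → T (reach k z)

  stable-suc : ∀ k → Stable k → Stable (suc k)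
  stable-suc k st z t with reach-suc (suc k) z t
  ... | inj₁ kz                = kz
  ... | inj₂ (Sz , y , ky , yz) = reach-step {k} (st y ky) yz Sz

  grow : ∀ k → suc k ≤ count (reach k) ⊎ Stable k
  grow zero = inj₁ (≤-reflexive (sym (count-singleton u)))
  grow (suc k) with grow k
  ... | inj₂ st = inj₂ (stable-suc k st)
  ... | inj₁ le with suc (count (reach k)) ≤? count (reach (suc k))
  ...   | yes lt = inj₁ (≤-trans (s≤s le) lt)
  ...   | no  ¬lt = inj₂ (stable-suc k (count-⊆-tight {f = reach k} (reach-mono k) (≮⇒≥ ¬lt)))

  -- The reachable sets grow strictly until they stabilise, so after n steps they are closed.
  component : Fin n → Bool
  component = reach n

  component-closed : ∀ {y z} → T (component y) → T (adj G y z) → lookup S z ≡ false →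
                     T (component z)
  component-closed {y} {z} cy yz Sz with grow n
  ... | inj₁ n<∣c∣ = contradiction (≤-trans n<∣c∣ (count≤n (reach n))) (<-irrefl refl)
  ... | inj₂ st    = st z (reach-step {n} cy yz Sz)

  reach-u : ∀ k → T (reach k u)
  reach-u zero with u ≟ u
  ... | yes _   = _
  ... | no  u≢u = contradiction refl u≢u
  reach-u (suc k) = reach-mono k u (reach-u k)

  side : Fin n → Side
  side z = if lookup S z then cut else if component z then left else right

  side-u : side u ≡ left
  side-u rewrite ∉⇒lookup u∉S with component u | reach-u n
  ... | true | _ = refl

  side-unreachable : ∀ {v} → v ∉ S → ¬ PathAvoid G S u v → side v ≡ right
  side-unreachable {v} v∉S ¬u⇝v rewrite ∉⇒lookup v∉S with component v in cv
  ... | true  = contradiction (reach-path n v (subst T (sym cv) _)) ¬u⇝v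
  ... | false = refl

  side≡left : ∀ z → side z ≡ left → T (component z)
  side≡left z sz with lookup S z | component z
  side≡left z sz | false | true  = _
  side≡left z () | true  | _
  side≡left z () | false | false

  side≡right : ∀ z → side z ≡ right → lookup S z ≡ false × component z ≡ false
  side≡right z sz with lookup S z | component z
  side≡right z sz | false | false = refl , refl
  side≡right z () | true  | _
  side≡right z () | false | true

  side-separates : Separates G side
  side-separates = separates-by-left-right {G = G} side noEdge
    where
    noEdge : ∀ i j → side i ≡ left → side j ≡ right → adj G i j ≡ false
    noEdge i j si sj with adj G i j in ij | side≡right j sj
    ... | false | _          = refl
    ... | true  | Sj , ¬cj = contradiction (component-closed (side≡left i si) (subst T (sym ij) _) Sj)
                                           (subst T ¬cj)

  ⁻¹cut≗lookup : ∀ z → (side ⁻¹ cut) z ≡ lookup S z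
  ⁻¹cut≗lookup z with lookup S z | component z
  ... | true  | _     = refl
  ... | false | true  = refl
  ... | false | false = refl

  side≡cut⇒∈ : ∀ z → side z ≡ cut → z ∈ S
  side≡cut⇒∈ z sz with lookup S z in Sz | component z
  side≡cut⇒∈ z sz | true  | _     = lookup⇒[]= z S Sz
  side≡cut⇒∈ z () | false | true
  side≡cut⇒∈ z () | false | false

  side≢cut⇒∉ : ∀ z → side z ≢ cut → z ∉ S
  side≢cut⇒∉ z sz with lookup S z in Sz
  ... | true  = contradiction refl sz
  ... | false = lookup⇒∉ Sz

-- Recognising the exceptional graph

block : ℕ → ℕ → ℕ → Side
block a b x = if x <ᵇ a then cut else if x <ᵇ b then left else right

<ᵇ-true : ∀ {m n} → m < n → (m <ᵇ n) ≡ true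
<ᵇ-true {m} {n} m<n with m <ᵇ n | <⇒<ᵇ m<n
... | true | _ = refl

<ᵇ-false : ∀ {m n} → n ≤ m → (m <ᵇ n) ≡ false
<ᵇ-false {m} {n} n≤m with m <ᵇ n in m<n
... | false = refl
... | true  = contradiction (<ᵇ⇒< m n (subst T (sym m<n) _)) (≤⇒≯ n≤m)

block-cut : ∀ {a b x} → x < a → block a b x ≡ cut
block-cut x<a rewrite <ᵇ-true x<a = refl

block-left : ∀ {a b x} → a ≤ x → x < b → block a b x ≡ left
block-left a≤x x<b rewrite <ᵇ-false a≤x | <ᵇ-true x<b = refl

block-right : ∀ {a b x} → a ≤ x → b ≤ x → block a b x ≡ right
block-right a≤x b≤x rewrite <ᵇ-false a≤x | <ᵇ-false b≤x = refl

toℕ-punchIn : ∀ {n} (t : Fin (suc n)) (k : Fin n) →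
  (toℕ k < toℕ t × toℕ (punchIn t k) ≡ toℕ k) ⊎
  (toℕ t ≤ toℕ k × toℕ (punchIn t k) ≡ suc (toℕ k))
toℕ-punchIn zero    k       = inj₂ (z≤n , refl)
toℕ-punchIn (suc t) zero    = inj₁ (s≤s z≤n , refl)
toℕ-punchIn (suc t) (suc k) with toℕ-punchIn t k
... | inj₁ (k<t , eq) = inj₁ (s≤s k<t , cong suc eq)
... | inj₂ (t≤k , eq) = inj₂ (s≤s t≤k , cong suc eq)

-- Inserting a new position at a (resp. a + b) shifts everything behind it by one,
-- which enlarges the left (resp. right) block and leaves the others in place.
block-punchIn-left : ∀ {n} a b (t : Fin (suc n)) → toℕ t ≡ a → ∀ k →
                     block a (a + suc b) (toℕ (punchIn t k)) ≡ block a (a + b) (toℕ k)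
block-punchIn-left a b t refl k with toℕ-punchIn t k
... | inj₁ (k<t , eq) rewrite eq =
  trans (block-cut {b = toℕ t + suc b} k<t) (sym (block-cut {b = toℕ t + b} k<t))
... | inj₂ (t≤k , eq) rewrite eq with toℕ k <? toℕ t + b
...   | yes k<t+b = trans
  (block-left (m≤n⇒m≤1+n t≤k) (subst (suc (suc (toℕ k)) ≤_) (sym (+-suc (toℕ t) b)) (s≤s k<t+b)))
  (sym (block-left t≤k k<t+b))
...   | no  k≮t+b = trans
  (block-right (m≤n⇒m≤1+n t≤k) (subst (_≤ suc (toℕ k)) (sym (+-suc (toℕ t) b)) (s≤s (≮⇒≥ k≮t+b))))
  (sym (block-right t≤k (≮⇒≥ k≮t+b)))

block-punchIn-right : ∀ {n} a b (t : Fin (suc n)) → toℕ t ≡ a + b → ∀ k →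
                      block a (a + b) (toℕ (punchIn t k)) ≡ block a (a + b) (toℕ k)
block-punchIn-right a b t t≡a+b k with toℕ-punchIn t k
... | inj₁ (_ , eq) = cong (block a (a + b)) eq
... | inj₂ (t≤k , eq) rewrite eq | t≡a+b =
  trans (block-right (≤-trans (m≤m+n a b) (m≤n⇒m≤1+n t≤k)) (m≤n⇒m≤1+n t≤k))
        (sym (block-right (≤-trans (m≤m+n a b) t≤k) t≤k))

sort : ∀ {n} (σ : Fin n → Side) {a b} → count (σ ⁻¹ cut) ≡ a → count (σ ⁻¹ left) ≡ b →
       Σ (Permutation′ n) λ φ → ∀ i → block a (a + b) (toℕ (φ ⟨$⟩ʳ i)) ≡ σ i
sort {zero}  σ _ _ = Perm.id , λ ()
sort {suc n} σ ca cb with σ zero in σ₀ | sort (σ ∘ suc) refl refl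
sort {suc n} σ refl refl | cut | φ , sorted = insert zero zero φ , sorted′
  where
  sorted′ : ∀ i → _
  sorted′ zero    = sym σ₀
  sorted′ (suc i) = sorted i
sort {suc n} σ refl refl | left | φ , sorted = insert zero t φ , sorted′
  where
  a b : ℕ
  a = count ((σ ∘ suc) ⁻¹ cut)
  b = count ((σ ∘ suc) ⁻¹ left)
  a<1+n : a < suc n
  a<1+n = s≤s (count≤n ((σ ∘ suc) ⁻¹ cut))
  t : Fin (suc n)
  t = fromℕ< a<1+n
  sorted′ : ∀ i → block a (a + suc b) (toℕ (insert zero t φ ⟨$⟩ʳ i)) ≡ σ i
  sorted′ zero    = trans (cong (block a (a + suc b)) (toℕ-fromℕ< a<1+n))
                      (trans (block-left ≤-refl (subst (a <_) (sym (+-suc a b)) (s≤s (m≤m+n a b)))) (sym σ₀))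
  sorted′ (suc i) = trans (block-punchIn-left a b t (toℕ-fromℕ< a<1+n) (φ ⟨$⟩ʳ i)) (sorted i)
sort {suc n} σ refl refl | right | φ , sorted = insert zero t φ , sorted′
  where
  a b : ℕ
  a = count ((σ ∘ suc) ⁻¹ cut)
  b = count ((σ ∘ suc) ⁻¹ left)
  a+b<1+n : a + b < suc n
  a+b<1+n = s≤s (subst (a + b ≤_) (count-sides (σ ∘ suc)) (m≤m+n (a + b) _))
  t : Fin (suc n)
  t = fromℕ< a+b<1+n
  sorted′ : ∀ i → block a (a + b) (toℕ (insert zero t φ ⟨$⟩ʳ i)) ≡ σ i
  sorted′ zero    = trans (cong (block a (a + b)) (toℕ-fromℕ< a+b<1+n))
                      (trans (block-right (m≤m+n a b) ≤-refl) (sym σ₀))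
  sorted′ (suc i) = trans (block-punchIn-right a b t (toℕ-fromℕ< a+b<1+n) (φ ⟨$⟩ʳ i)) (sorted i)

≅-deg : ∀ {n m} {G : Graph n} {H : Graph m} ((φ , _) : G ≅ H) i → deg H (Inverse.to φ i) ≡ deg G i
≅-deg {n} {m} {G = G} {H} (φ , pres) i = begin
  deg H (to i)                      ≡⟨ count-tabulate (adj H (to i)) ⟩
  count (adj H (to i))              ≡⟨ ∑-permute (𝟙 ∘ adj H (to i)) φ ⟩
  count (λ j → adj H (to i) (to j)) ≡⟨ sum-cong-≗ (λ j → cong 𝟙 (pres i j)) ⟨
  count (adj G i)                   ≡⟨ count-tabulate (adj G i) ⟨
  deg G i                           ∎
  where
  open ≡-Reasoning
  to : Fin n → Fin m
  to = Inverse.to φ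

≅-deleteEdge : ∀ {n m} {G : Graph n} {H : Graph m} ((φ , pres) : G ≅ H) x y →
               deleteEdge G x y ≅ deleteEdge H (Inverse.to φ x) (Inverse.to φ y)
≅-deleteEdge (φ , pres) x y = φ , λ i j →
  cong₂ (λ a p → a ∧ not p) (pres i j)
    (sym (cong₂ _∨_ (cong₂ _∧_ (inj i x) (inj j y)) (cong₂ _∧_ (inj i y) (inj j x))))
  where inj = does-≟-↔ φ

sideGraph-relabel : ∀ {n m} {σ : Fin n → Side} {τ : Fin m → Side} (φ : Fin n ↔ Fin m) →
                    (∀ i → τ (Inverse.to φ i) ≡ σ i) → sideGraph σ ≅ sideGraph τ
sideGraph-relabel {σ = σ} {τ} φ relabel = φ , λ i j →
  sym (cong₂ (λ d o → not d ∧ not o)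
    (does-≟-↔ φ i j)
    (cong₂ opposite (relabel i) (relabel j)))

data SplitView (a b : ℕ) : Fin (a + b) → Set where
  inˡ : (x : Fin a) → SplitView a b (x ↑ˡ b)
  inʳ : (y : Fin b) → SplitView a b (a ↑ʳ y)

splitView : ∀ a b k → SplitView a b k
splitView a b k with splitAt a {b} k in eq
... | inj₁ x = subst (SplitView a b) (splitAt⁻¹-↑ˡ eq) (inˡ x)
... | inj₂ y = subst (SplitView a b) (splitAt⁻¹-↑ʳ eq) (inʳ y)

↑ˡ≢↑ʳ : ∀ {a b} (x : Fin a) (y : Fin b) → x ↑ˡ b ≢ a ↑ʳ y
↑ˡ≢↑ʳ {a} {b} x y eq = <-irrefl (trans (sym (toℕ-↑ˡ x b)) (trans (cong toℕ eq) (toℕ-↑ʳ a y)))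
  (≤-trans (toℕ<n x) (m≤m+n a (toℕ y)))

-- The summand of K_a ∨ (K_b ∪ K_c) that a vertex comes from.
baseSide : ∀ a b c → Fin (a + (b + c)) → Side
baseSide a b c k = block a (a + b) (toℕ k)

baseSide-cut : ∀ {a} b c (x : Fin a) → baseSide a b c (x ↑ˡ (b + c)) ≡ cut
baseSide-cut {a} b c x = block-cut {b = a + b} (subst (_< a) (sym (toℕ-↑ˡ x (b + c))) (toℕ<n x))

baseSide-left : ∀ a {b} c (y : Fin b) → baseSide a b c (a ↑ʳ (y ↑ˡ c)) ≡ left
baseSide-left a c y rewrite toℕ-↑ʳ a (y ↑ˡ c) | toℕ-↑ˡ y c = block-left (m≤m+n a _) (+-monoʳ-< a (toℕ<n y))

baseSide-right : ∀ a b {c} (z : Fin c) → baseSide a b c (a ↑ʳ (b ↑ʳ z)) ≡ right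
baseSide-right a b z rewrite toℕ-↑ʳ a (b ↑ʳ z) | toℕ-↑ʳ b z =
  block-right (m≤m+n a _) (+-monoʳ-≤ a (m≤m+n b (toℕ z)))

sideAdj-cong : ∀ {d d′ s₁ s₁′ s₂ s₂′} → d ≡ d′ → s₁ ≡ s₁′ → s₂ ≡ s₂′ →
               not d ∧ not (opposite s₁ s₂) ≡ not d′ ∧ not (opposite s₁′ s₂′)
sideAdj-cong refl refl refl = refl

base≗sideGraph : ∀ a b c k l → adj (K a ∨ᴳ (K b ∪ᴳ K c)) k l ≡ adj (sideGraph (baseSide a b c)) k l
base≗sideGraph a b c k l with splitView a (b + c) k | splitView a (b + c) l
... | inˡ x | inˡ x′ rewrite splitAt-↑ˡ a x (b + c) | splitAt-↑ˡ a x′ (b + c) =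
  sym (trans (sideAdj-cong (does-≟-injective (↑ˡ-injective (b + c) _ _) x x′)
                           (baseSide-cut b c x) (baseSide-cut b c x′)) (∧-identityʳ _))
... | inˡ x | inʳ y rewrite splitAt-↑ˡ a x (b + c) | splitAt-↑ʳ a (b + c) y =
  sym (sideAdj-cong (does-≢ (↑ˡ≢↑ʳ x y)) (baseSide-cut b c x) refl)
... | inʳ y | inˡ x rewrite splitAt-↑ˡ a x (b + c) | splitAt-↑ʳ a (b + c) y =
  sym (trans (sideAdj-cong (does-≢ (↑ˡ≢↑ʳ x y ∘ sym)) refl (baseSide-cut b c x))
             (cong (λ o → true ∧ not o) (opposite-sym (baseSide a b c (a ↑ʳ y)) cut)))
... | inʳ y | inʳ y′ rewrite splitAt-↑ʳ a (b + c) y | splitAt-↑ʳ a (b + c) y′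
  with splitView b c y | splitView b c y′
...   | inˡ u | inˡ u′ rewrite splitAt-↑ˡ b u c | splitAt-↑ˡ b u′ c =
  sym (trans (sideAdj-cong (does-≟-injective (↑ˡ-injective c _ _ ∘ ↑ʳ-injective a _ _) u u′)
                           (baseSide-left a c u) (baseSide-left a c u′)) (∧-identityʳ _))
...   | inˡ u | inʳ z rewrite splitAt-↑ˡ b u c | splitAt-↑ʳ b c z =
  sym (trans (sideAdj-cong refl (baseSide-left a c u) (baseSide-right a b z)) (∧-zeroʳ _))
...   | inʳ z | inˡ u rewrite splitAt-↑ˡ b u c | splitAt-↑ʳ b c z =
  sym (trans (sideAdj-cong refl (baseSide-right a b z) (baseSide-left a c u)) (∧-zeroʳ _))
...   | inʳ z | inʳ z′ rewrite splitAt-↑ʳ b c z | splitAt-↑ʳ b c z′ =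
  sym (trans (sideAdj-cong (does-≟-injective (↑ʳ-injective b _ _ ∘ ↑ʳ-injective a _ _) z z′)
                           (baseSide-right a b z) (baseSide-right a b z′)) (∧-identityʳ _))

sideGraph-≅ : ∀ {n} (σ : Fin n → Side) {a b c} → count (σ ⁻¹ cut) ≡ a → count (σ ⁻¹ left) ≡ b →
              count (σ ⁻¹ right) ≡ c → sideGraph σ ≅ (K a ∨ᴳ (K b ∪ᴳ K c))
sideGraph-≅ {n} σ {a} {b} {c} ca cb cc =
  ψ , λ i j → trans (proj₂ relabelled i j) (sym (base≗sideGraph a b c _ _))
  where
  n≡ : n ≡ a + (b + c)
  n≡ = trans (sym (count-sides σ)) (trans (cong₂ _+_ (cong₂ _+_ ca cb) cc) (+-assoc a b c))
  sorted : Σ (Permutation′ n) λ φ → ∀ i → block a (a + b) (toℕ (φ ⟨$⟩ʳ i)) ≡ σ i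
  sorted = sort σ ca cb
  ψ : Fin n ↔ Fin (a + (b + c))
  ψ = proj₁ sorted ∘ₚ cast-id n≡
  relabel : ∀ i → baseSide a b c (ψ ⟨$⟩ʳ i) ≡ σ i
  relabel i = trans (cong (block a (a + b)) (toℕ-cast n≡ (proj₁ sorted ⟨$⟩ʳ i))) (proj₂ sorted i)
  relabelled : sideGraph σ ≅ sideGraph (baseSide a b c)
  relabelled = sideGraph-relabel {τ = baseSide a b c} ψ relabel

deleteEdge-sideGraph⇒exceptional : ∀ {n} (G : Graph n) δ (σ : Fin n → Side) {w y} →
  σ w ≡ left → σ y ≡ cut → count (σ ⁻¹ cut) ≡ δ → count (σ ⁻¹ left) ≡ 2 →
  (∀ i j → adj G i j ≡ adj (deleteEdge (sideGraph σ) w y) i j) → Exceptional G δ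
deleteEdge-sideGraph⇒exceptional {n} G δ σ {w} {y} σw σy cδ c2 G≗ =
  to w , to y , edge , deg-w , deg-y ,
  (proj₁ iso , λ i j → trans (G≗ i j) (proj₂ (≅-deleteEdge {G = sideGraph σ} {H = Base n δ} iso w y) i j))
  where
  q : ℕ
  q = count (σ ⁻¹ right)
  n≡ : δ + 2 + q ≡ n
  n≡ = trans (cong₂ (λ a b → a + b + q) (sym cδ) (sym c2)) (count-sides σ)
  iso : sideGraph σ ≅ Base n δ
  iso = sideGraph-≅ σ cδ c2 (sym (trans (cong (λ m → m ∸ δ ∸ 2) (trans (sym n≡) (+-assoc δ 2 q)))
                                       (cong (_∸ 2) (m+n∸m≡n δ (2 + q)))))
  to : Fin n → Fin (δ + (2 + (n ∸ δ ∸ 2)))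
  to = Inverse.to (proj₁ iso)
  degree : ∀ {c} i → σ i ≡ c → deg (Base n δ) (to i) + across σ c + 1 ≡ n
  degree i σi = trans (cong₂ (λ d c → d + across σ c + 1) (≅-deg {G = sideGraph σ} {H = Base n δ} iso i) (sym σi))
                      (deg-sideGraph σ i)
  edge : T (adj (Base n δ) (to w) (to y))
  edge = subst T (proj₂ iso w y) (subst T (sym (sideAdj-cong (does-≢ w≢y) σw σy)) _)
    where
    w≢y : w ≢ y
    w≢y refl = contradiction (trans (sym σw) σy) λ ()
  deg-w : deg (Base n δ) (to w) ≡ suc δ
  deg-w = +-cancelʳ-≡ (q + 1) _ _
    (trans (sym (+-assoc _ q 1)) (trans (degree w σw) (trans (sym n≡) (regroup δ q))))
    where
    regroup : ∀ δ q → δ + 2 + q ≡ suc δ + (q + 1)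
    regroup = solve-∀
  deg-y : deg (Base n δ) (to y) ≡ n ∸ 1
  deg-y = sym (trans (cong (_∸ 1) (sym (degree y σy)))
                     (trans (cong (λ d → d + 1 ∸ 1) (+-identityʳ d)) (m+n∸n≡m d 1)))
    where d = deg (Base n δ) (to y)

product-too-small : ∀ {p q} → 2 ≤ p → 2 ≤ q → ¬ (p * q + q * p + 5 ≤ 3 * p + 3 * q)
product-too-small (s≤s (s≤s (z≤n {p}))) (s≤s (s≤s (z≤n {q}))) le =
  m+1+n≰m (3 * (2 + p) + 3 * (2 + q)) (subst (_≤ 3 * (2 + p) + 3 * (2 + q)) (expand p q) le)
  where
  expand : ∀ p q → (2 + p) * (2 + q) + (2 + q) * (2 + p) + 5 ≡
                   3 * (2 + p) + 3 * (2 + q) + suc (p + q + 2 * (p * q))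
  expand = solve-∀

cut-case-arith : ∀ {n δ s p q c N} → N + 4 * δ + 6 ≤ 4 * n → δ + c + 1 ≡ n → s + p + q ≡ n →
                 s ≤ δ → 2 ≤ p → 2 ≤ q → p * q + q * p + c ≤ N → ⊥
cut-case-arith {n} {δ} {s} {p} {q} {c} {N} bound n≡ n≡′ s≤δ 2≤p 2≤q lower =
  product-too-small 2≤p 2≤q (+-cancelʳ-≤ (c + 4 * δ + 1) _ _ (begin
    p * q + q * p + 5 + (c + 4 * δ + 1) ≡⟨ shuffle (p * q + q * p) c δ ⟩
    p * q + q * p + c + 4 * δ + 6       ≤⟨ +-monoˡ-≤ 6 (+-monoˡ-≤ (4 * δ) lower) ⟩
    N + 4 * δ + 6                       ≤⟨ bound ⟩
    4 * n                               ≡⟨ split n ⟩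
    n + 3 * n                           ≡⟨ cong₂ (λ a b → a + 3 * b) n≡ n≡′ ⟨
    δ + c + 1 + 3 * (s + p + q)
      ≤⟨ +-monoʳ-≤ (δ + c + 1) (*-monoʳ-≤ 3 (+-monoˡ-≤ q (+-monoˡ-≤ p s≤δ))) ⟩
    δ + c + 1 + 3 * (δ + p + q)         ≡⟨ regroup δ c p q ⟩
    3 * p + 3 * q + (c + 4 * δ + 1)     ∎))
  where
  open ≤-Reasoning
  shuffle : ∀ x c δ → x + 5 + (c + 4 * δ + 1) ≡ x + c + 4 * δ + 6
  shuffle = solve-∀
  split : ∀ n → 4 * n ≡ n + 3 * n
  split = solve-∀
  regroup : ∀ δ c p q → δ + c + 1 + 3 * (δ + p + q) ≡ 3 * p + 3 * q + (c + 4 * δ + 1)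
  regroup = solve-∀

p≡2∧e≡1 : ∀ {p q e} → 2 ≤ p → 2 ≤ q → p * q + 1 ≤ 2 * q + e → e + 1 ≤ p → p ≡ 2 × e ≡ 1
p≡2∧e≡1 {q = q} {e} (s≤s (s≤s (z≤n {zero}))) _ 2q+1≤2q+e e+1≤2 =
  refl , ≤-antisym (≤-pred (subst (_≤ 2) (+-comm e 1) e+1≤2)) (+-cancelˡ-≤ (2 * q) 1 e 2q+1≤2q+e)
p≡2∧e≡1 {e = e} (s≤s (s≤s (z≤n {suc p}))) (s≤s (s≤s (z≤n {q}))) pq+1≤2q+e e+1≤p =
  contradiction (subst₂ _≤_ (expandˡ p q) (expandʳ p q)
    (≤-trans pq+1≤2q+e (+-monoʳ-≤ (2 * (2 + q)) (≤-pred (subst (_≤ 3 + p) (+-comm e 1) e+1≤p)))))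
    (m+1+n≰m (6 + 2 * q + p))
  where
  expandˡ : ∀ p q → (3 + p) * (2 + q) + 1 ≡ 6 + 2 * q + p + suc (q + p + p * q)
  expandˡ = solve-∀
  expandʳ : ∀ p q → 2 * (2 + q) + (2 + p) ≡ 6 + 2 * q + p
  expandʳ = solve-∀

pq+1≤2q+e : ∀ {n δ p q e N} → N + 4 * δ + 6 ≤ 4 * n → δ + (q + e) + 1 ≡ n →
           p * q + q * p + e + e ≤ N → p * q + 1 ≤ 2 * q + e
pq+1≤2q+e {n} {δ} {p} {q} {e} {N} bound n≡ lower =
  *-cancelˡ-≤ 2 (+-cancelʳ-≤ (2 * e + 4 * δ + 4) _ _ (begin
  2 * (p * q + 1) + (2 * e + 4 * δ + 4) ≡⟨ shuffle p q e δ ⟩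
  p * q + q * p + e + e + 4 * δ + 6     ≤⟨ +-monoˡ-≤ 6 (+-monoˡ-≤ (4 * δ) lower) ⟩
  N + 4 * δ + 6                         ≤⟨ bound ⟩
  4 * n                                 ≡⟨ cong (4 *_) n≡ ⟨
  4 * (δ + (q + e) + 1)                 ≡⟨ regroup q e δ ⟩
  2 * (2 * q + e) + (2 * e + 4 * δ + 4) ∎))
  where
  open ≤-Reasoning
  shuffle : ∀ p q e δ → 2 * (p * q + 1) + (2 * e + 4 * δ + 4) ≡ p * q + q * p + e + e + 4 * δ + 6
  shuffle = solve-∀
  regroup : ∀ q e δ → 4 * (δ + (q + e) + 1) ≡ 2 * (2 * q + e) + (2 * e + 4 * δ + 4)
  regroup = solve-∀

e+1≤p : ∀ {n δ s p q e} → δ + (q + e) + 1 ≡ n → s + p + q ≡ n → s ≤ δ → e + 1 ≤ p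
e+1≤p {n} {δ} {s} {p} {q} {e} n≡ n≡′ s≤δ = +-cancelʳ-≤ (δ + q) _ _ (begin
  e + 1 + (δ + q) ≡⟨ regroup e δ q ⟩
  δ + (q + e) + 1 ≡⟨ trans n≡ (sym n≡′) ⟩
  s + p + q       ≤⟨ +-monoˡ-≤ q (+-monoˡ-≤ p s≤δ) ⟩
  δ + p + q       ≡⟨ regroup′ δ p q ⟩
  p + (δ + q)     ∎)
  where
  open ≤-Reasoning
  regroup : ∀ e δ q → e + 1 + (δ + q) ≡ δ + (q + e) + 1
  regroup = solve-∀
  regroup′ : ∀ δ p q → δ + p + q ≡ p + (δ + q)
  regroup′ = solve-∀

left-case-arith : ∀ {n δ s p q e N} → N + 4 * δ + 6 ≤ 4 * n → δ + (q + e) + 1 ≡ n → s + p + q ≡ n →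
                  s ≤ δ → 2 ≤ p → 2 ≤ q → p * q + q * p + e + e ≤ N →
                  p ≡ 2 × e ≡ 1 × s ≡ δ × N ≤ p * q + q * p + e + e
left-case-arith {n} {δ} {s} {p} {q} {e} {N} bound n≡ n≡′ s≤δ 2≤p 2≤q lower
  with p≡2∧e≡1 2≤p 2≤q (pq+1≤2q+e {n} {δ} {p} {q} {e} {N} bound n≡ lower)
                       (e+1≤p {n} {δ} {s} {p} {q} {e} n≡ n≡′ s≤δ)
... | refl , refl = refl , refl , s≡δ , N≤
  where
  s≡δ : s ≡ δ
  s≡δ = +-cancelʳ-≡ (2 + q) s δ (trans (regroup s q) (trans n≡′ (trans (sym n≡) (regroup′ δ q))))
    where
    regroup : ∀ s q → s + (2 + q) ≡ s + 2 + q
    regroup = solve-∀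
    regroup′ : ∀ δ q → δ + (q + 1) + 1 ≡ δ + (2 + q)
    regroup′ = solve-∀
  N≤ : N ≤ 2 * q + q * 2 + 1 + 1
  N≤ = +-cancelʳ-≤ (4 * δ + 6) _ _ (begin
    N + (4 * δ + 6)                     ≡⟨ +-assoc N (4 * δ) 6 ⟨
    N + 4 * δ + 6                       ≤⟨ bound ⟩
    4 * n                               ≡⟨ cong (4 *_) n≡ ⟨
    4 * (δ + (q + 1) + 1)               ≡⟨ regroup q δ ⟩
    2 * q + q * 2 + 1 + 1 + (4 * δ + 6) ∎)
    where
    open ≤-Reasoning
    regroup : ∀ q δ → 4 * (δ + (q + 1) + 1) ≡ 2 * q + q * 2 + 1 + 1 + (4 * δ + 6)
    regroup = solve-∀

module Separated {n} (G : Graph n) (σ : Fin n → Side) (sep : Separates G σ) where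

  ∣cut∣ ∣left∣ ∣right∣ : ℕ
  ∣cut∣   = count (σ ⁻¹ cut)
  ∣left∣  = count (σ ⁻¹ left)
  ∣right∣ = count (σ ⁻¹ right)

  opposite⇒nonadj : ∀ {i j} → T (opposite (σ i) (σ j)) → T (nonadj G i j)
  opposite⇒nonadj {i} {j} opp = nonadj-intro {G = G} (sep i j opp) λ { refl → T-opposite⇒≢ opp refl }

  across≤codeg : ∀ i → across σ (σ i) ≤ codeg G i
  across≤codeg i = subst (_≤ codeg G i) (count-opposite σ (σ i))
                          (count-mono {f = λ j → opposite (σ i) (σ j)} (λ j → opposite⇒nonadj))

  sum-across : sum (across σ ∘ σ) ≡ ∣left∣ * ∣right∣ + ∣right∣ * ∣left∣
  sum-across = trans (sum-by-side σ (across σ))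
                     (cong (λ z → z + ∣left∣ * ∣right∣ + ∣right∣ * ∣left∣) (*-zeroʳ ∣cut∣))

  cut-codeg-bound : ∀ {w} → σ w ≡ cut → ∣left∣ * ∣right∣ + ∣right∣ * ∣left∣ + codeg G w ≤ sum (codeg G)
  cut-codeg-bound {w} σw =
    subst (_≤ sum (codeg G)) (trans (sum-bump (across σ ∘ σ) w (codeg G w)) (cong (_+ codeg G w) sum-across))
      (sum-mono-≤ bound)
    where
    bound : ∀ i → across σ (σ i) + 𝟙 (does (i ≟ w)) * codeg G w ≤ codeg G i
    bound i with i ≟ w
    ... | yes refl rewrite σw = ≤-reflexive (+-identityʳ (codeg G i))
    ... | no  _    = subst (_≤ codeg G i) (sym (+-identityʳ _)) (across≤codeg i)

  alone⇒isolated : ∀ {c z} → c ≢ cut → σ z ≡ c → count (σ ⁻¹ c) ≤ 1 → ∀ j → T (adj G z j) → σ j ≡ cut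
  alone⇒isolated {c} {z} c≢cut σz ∣c∣≤1 j zj with σ j ≟ˢ cut | σ j ≟ˢ c
  ... | yes σj | _     = σj
  ... | no σj≢cut | no σj≢c  = contradiction zj λ zj′ →
    subst T (sep z j (noncut-opposite (subst (_≢ cut) (sym σz) c≢cut) σj≢cut
                                      λ e → σj≢c (trans (sym e) σz))) zj′
  ... | no σj≢cut | yes σj≡c
    with count≤1⇒unique {f = σ ⁻¹ c} {i = z} {j = j} ∣c∣≤1 (≡⇒T⁻¹ {σ = σ} σz) (≡⇒T⁻¹ {σ = σ} σj≡c)
  ...   | refl = contradiction (subst T (adj-irr G z) zj) λ ()

module VertexOnLeft {n} (G : Graph n) (σ : Fin n → Side) (sep : Separates G σ)
                    (w : Fin n) (σw : σ w ≡ left) where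

  open Separated G σ sep

  -- The non-neighbours of w that the separation does not account for.
  unforced : Fin n → Bool
  unforced j = nonadj G w j ∧ not ((σ ⁻¹ right) j)

  e : ℕ
  e = count unforced

  unforced-w : unforced w ≡ false
  unforced-w rewrite adj-irr G w | does-≟-refl w = refl

  unforced⇒¬right : ∀ {j} → T (unforced j) → ¬ T ((σ ⁻¹ right) j)
  unforced⇒¬right {j} u r =
    subst T (Equivalence.to T-not-≡ (proj₂ (Equivalence.to (T-∧ {nonadj G w j}) u))) r

  codeg-w : codeg G w ≡ ∣right∣ + e
  codeg-w = trans (sum-cong-≗ (cong 𝟙 ∘ split))
                  (count-∨-disjoint (σ ⁻¹ right) unforced λ j r u → unforced⇒¬right u r)
    where
    split : ∀ j → nonadj G w j ≡ (σ ⁻¹ right) j ∨ unforced j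
    split j with (σ ⁻¹ right) j in σj
    ... | true  = Equivalence.to T-≡ (opposite⇒nonadj (subst₂ (λ a b → T (opposite a b)) (sym σw)
                    (sym (T⁻¹⇒≡ {σ = σ} (subst T (sym σj) _))) _))
    ... | false = sym (∧-identityʳ _)

  row : Fin n → Fin n → Bool
  row i j = opposite (σ i) (σ j) ∨ (unforced i ∧ does (j ≟ w))

  row⊆nonadj : ∀ i j → T (row i j) → T (nonadj G i j)
  row⊆nonadj i j t with Equivalence.to (T-∨ {opposite (σ i) (σ j)}) t
  ... | inj₁ opp = opposite⇒nonadj opp
  ... | inj₂ u∧j≡w with Equivalence.to (T-∧ {unforced i}) u∧j≡w
  ...   | u , j≡w rewrite T-≟⇒≡ {j = j} j≡w =
    nonadj-sym {G = G} (proj₁ (Equivalence.to (T-∧ {nonadj G w i}) u))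

  count-row : ∀ i → count (row i) ≡ across σ (σ i) + 𝟙 (unforced i)
  count-row i = begin
    count (row i)
      ≡⟨ count-∨-disjoint (λ j → opposite (σ i) (σ j)) (λ j → unforced i ∧ does (j ≟ w)) disj ⟩
    count (λ j → opposite (σ i) (σ j)) + count (λ j → unforced i ∧ does (j ≟ w))
      ≡⟨ cong₂ _+_ (count-opposite σ (σ i)) (count-∧ˡ (unforced i) (λ j → does (j ≟ w))) ⟩
    across σ (σ i) + 𝟙 (unforced i) * count (λ j → does (j ≟ w))
      ≡⟨ cong (λ c → across σ (σ i) + 𝟙 (unforced i) * c) (count-singleton w) ⟩
    across σ (σ i) + 𝟙 (unforced i) * 1
      ≡⟨ cong (across σ (σ i) +_) (*-identityʳ _) ⟩
    across σ (σ i) + 𝟙 (unforced i) ∎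
    where
    open ≡-Reasoning
    disj : ∀ j → T (opposite (σ i) (σ j)) → T (unforced i ∧ does (j ≟ w)) → ⊥
    disj j opp u∧j≡w with Equivalence.to (T-∧ {unforced i}) u∧j≡w
    ... | u , j≡w rewrite T-≟⇒≡ {j = j} j≡w =
      unforced⇒¬right u (≡⇒T⁻¹ {σ = σ} (opposite-left⇒right (subst (λ c → T (opposite (σ i) c)) σw opp)))

  -- A lower bound for codeg; w is credited with its e unforced non-neighbours
  -- and each of them with w.
  lower : Fin n → ℕ
  lower i = count (row i) + 𝟙 (does (i ≟ w)) * e

  lower-w : lower w ≡ codeg G w
  lower-w = begin
    count (row w) + 𝟙 (does (w ≟ w)) * e ≡⟨ cong (λ b → count (row w) + 𝟙 b * e) (does-≟-refl w) ⟩
    count (row w) + 1 * e               ≡⟨ cong₂ _+_ (count-row w) (*-identityˡ e) ⟩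
    across σ (σ w) + 𝟙 (unforced w) + e ≡⟨ cong₂ (λ c u → across σ c + 𝟙 u + e) σw unforced-w ⟩
    ∣right∣ + 0 + e                     ≡⟨ cong (_+ e) (+-identityʳ ∣right∣) ⟩
    ∣right∣ + e                         ≡⟨ codeg-w ⟨
    codeg G w                           ∎
    where open ≡-Reasoning

  lower-≢ : ∀ {i} → i ≢ w → lower i ≡ count (row i)
  lower-≢ {i} i≢w = trans (cong (λ b → count (row i) + 𝟙 b * e) (does-≢ i≢w)) (+-identityʳ _)

  lower≤codeg : ∀ i → lower i ≤ codeg G i
  lower≤codeg i = by (i ≟ w)
    where
    by : Dec (i ≡ w) → lower i ≤ codeg G i
    by (yes i≡w) = subst (λ k → lower k ≤ codeg G k) (sym i≡w) (≤-reflexive lower-w)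
    by (no  i≢w) = subst (_≤ codeg G i) (sym (lower-≢ i≢w)) (count-mono (row⊆nonadj i))

  sum-lower : sum lower ≡ ∣left∣ * ∣right∣ + ∣right∣ * ∣left∣ + e + e
  sum-lower = begin
    sum lower                                       ≡⟨ sum-bump (count ∘ row) w e ⟩
    sum (count ∘ row) + e                           ≡⟨ cong (_+ e) (sum-cong-≗ count-row) ⟩
    sum (λ i → across σ (σ i) + 𝟙 (unforced i)) + e
      ≡⟨ cong (_+ e) (∑-distrib-+ (across σ ∘ σ) (𝟙 ∘ unforced)) ⟩
    sum (across σ ∘ σ) + e + e                      ≡⟨ cong (λ x → x + e + e) sum-across ⟩
    ∣left∣ * ∣right∣ + ∣right∣ * ∣left∣ + e + e       ∎
    where open ≡-Reasoning

  codeg-lower-bound : ∣left∣ * ∣right∣ + ∣right∣ * ∣left∣ + e + e ≤ sum (codeg G)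
  codeg-lower-bound = subst (_≤ sum (codeg G)) sum-lower (sum-mono-≤ lower≤codeg)

  nonadj-classified : sum (codeg G) ≤ ∣left∣ * ∣right∣ + ∣right∣ * ∣left∣ + e + e →
    ∀ i j → T (nonadj G i j) →
    T (opposite (σ i) (σ j)) ⊎ (i ≡ w × T (unforced j)) ⊎ (T (unforced i) × j ≡ w)
  nonadj-classified tight i j ij = by (i ≟ w)
    where
    Classified : Set
    Classified = T (opposite (σ i) (σ j)) ⊎ (i ≡ w × T (unforced j)) ⊎ (T (unforced i) × j ≡ w)
    from-w : i ≡ w → Classified
    from-w refl with (σ ⁻¹ right) j in σj
    ... | true  = inj₁ (subst₂ (λ a b → T (opposite a b)) (sym σw)
                                (sym (T⁻¹⇒≡ {σ = σ} (subst T (sym σj) _))) _)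
    ... | false = inj₂ (inj₁ (refl , Equivalence.from (T-∧ {nonadj G w j}) (ij , _)))
    from-row : T (row i j) → Classified
    from-row t with Equivalence.to (T-∨ {opposite (σ i) (σ j)}) t
    ... | inj₁ opp = inj₁ opp
    ... | inj₂ u∧j≡w with Equivalence.to (T-∧ {unforced i}) u∧j≡w
    ...   | u , j≡w = inj₂ (inj₂ (u , T-≟⇒≡ j≡w))
    by : Dec (i ≡ w) → Classified
    by (yes i≡w) = from-w i≡w
    by (no  i≢w) = from-row (count-⊆-tight (row⊆nonadj i)
      (subst (codeg G i ≤_) (lower-≢ i≢w)
        (sum-≤-tight lower≤codeg (subst (sum (codeg G) ≤_) (sym sum-lower) tight) i))
      j ij)

  module UniqueUnforced (tight : sum (codeg G) ≤ ∣left∣ * ∣right∣ + ∣right∣ * ∣left∣ + e + e)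
                        {y} (uy : T (unforced y)) (only-y : ∀ {j} → T (unforced j) → j ≡ y) where

    w≁y : T (nonadj G w y)
    w≁y = proj₁ (Equivalence.to (T-∧ {nonadj G w y}) uy)

    w≢y : w ≢ y
    w≢y w≡y = nonadj⇒≢ {G = G} w≁y (sym w≡y)

    w-isolated : σ y ≡ left → ∣left∣ ≤ 2 → ∀ j → T (adj G w j) → σ j ≡ cut
    w-isolated σy ∣left∣≤2 j wj with σ j ≟ˢ cut | σ j ≟ˢ left
    ... | yes σj≡cut | _ = σj≡cut
    ... | no σj≢cut | no σj≢left = contradiction wj λ wj′ →
      subst T (sep w j (noncut-opposite (subst (_≢ cut) (sym σw) λ ()) σj≢cut
                                        λ e → σj≢left (trans (sym e) σw))) wj′
    ... | no _ | yes σj≡left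
      with count≤2⇒pair {f = σ ⁻¹ left} ∣left∣≤2 (≡⇒T⁻¹ {σ = σ} σw) (≡⇒T⁻¹ {σ = σ} σy) w≢y
                        (≡⇒T⁻¹ {σ = σ} σj≡left)
    ...   | inj₁ refl = contradiction (subst T (adj-irr G w) wj) λ ()
    ...   | inj₂ refl = contradiction (subst T (nonadj⇒¬adj {G = G} w≁y) wj) λ ()

    adjacency : ∀ i j → adj G i j ≡ adj (deleteEdge (sideGraph σ) w y) i j
    adjacency i j with adj G i j in ij
    ... | true  = sym kept
      where
      ¬opp : ¬ T (opposite (σ i) (σ j))
      ¬opp opp = contradiction (trans (sym ij) (sep i j opp)) λ ()
      ¬pair : ¬ T (isPair w y i j)
      ¬pair p with isPair-elim {x = w} {y} {i} {j} p
      ... | inj₁ (refl , refl) = contradiction (trans (sym ij) (nonadj⇒¬adj {G = G} w≁y)) λ ()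
      ... | inj₂ (refl , refl) =
        contradiction (trans (sym ij) (trans (adj-sym G y w) (nonadj⇒¬adj {G = G} w≁y))) λ ()
      i≢j : i ≢ j
      i≢j refl = contradiction (trans (sym ij) (adj-irr G i)) λ ()
      kept : adj (deleteEdge (sideGraph σ) w y) i j ≡ true
      kept rewrite does-≢ i≢j | ¬T⇒≡false ¬opp | ¬T⇒≡false ¬pair = refl
    ... | false = sym (by (i ≟ j))
      where
      removed : T (isPair w y i j) → adj (deleteEdge (sideGraph σ) w y) i j ≡ false
      removed p rewrite Equivalence.to T-≡ p = ∧-zeroʳ _
      by : Dec (i ≡ j) → adj (deleteEdge (sideGraph σ) w y) i j ≡ false
      by (yes refl) rewrite does-≟-refl i = refl
      by (no i≢j) with nonadj-classified tight i j (nonadj-intro {G = G} ij (i≢j ∘ sym))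
      ... | inj₁ opp rewrite Equivalence.to T-≡ opp =
        cong (_∧ not (isPair w y i j)) (∧-zeroʳ (not (does (i ≟ j))))
      ... | inj₂ (inj₁ (refl , uj)) =
        removed (subst (λ k → T (isPair w y w k)) (sym (only-y uj)) (subst T (sym (isPair-refl w y)) _))
      ... | inj₂ (inj₂ (ui , refl)) =
        removed (subst (λ k → T (isPair w y k w)) (sym (only-y ui)) (subst T (sym (isPair-swap w y)) _))

  isolated-or-exceptional : ∀ {δ} → sum (codeg G) + 4 * δ + 6 ≤ 4 * n → deg G w ≡ δ → ∣cut∣ ≤ δ →
    2 ≤ ∣left∣ → 2 ≤ ∣right∣ → (∀ j → T (adj G w j) → σ j ≡ cut) ⊎ Exceptional G δ
  isolated-or-exceptional {δ} bound dw ∣cut∣≤δ 2≤∣left∣ 2≤∣right∣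
    with left-case-arith bound (trans (cong₂ (λ d c → d + c + 1) (sym dw) (sym codeg-w)) (deg+codeg G w))
                         (count-sides σ) ∣cut∣≤δ 2≤∣left∣ 2≤∣right∣ codeg-lower-bound
  ... | ∣left∣≡2 , e≡1 , ∣cut∣≡δ , tight with 1≤count⇒∃ unforced (≤-reflexive (sym e≡1))
  ...   | y , uy = by-side (σ y) refl
    where
    open UniqueUnforced tight uy (count≤1⇒unique (≤-reflexive e≡1) uy)
    by-side : ∀ c → σ y ≡ c → (∀ j → T (adj G w j) → σ j ≡ cut) ⊎ Exceptional G δ
    by-side cut   σy = inj₂ (deleteEdge-sideGraph⇒exceptional G δ σ σw σy ∣cut∣≡δ ∣left∣≡2 adjacency)
    by-side left  σy = inj₁ (w-isolated σy (≤-reflexive ∣left∣≡2))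
    by-side right σy = contradiction (≡⇒T⁻¹ {σ = σ} σy) (unforced⇒¬right uy)

cut-neighbourhood⇒deg≡δ : ∀ {n δ} (G : Graph n) (σ : Fin n → Side) → (∀ v → δ ≤ deg G v) →
  count (σ ⁻¹ cut) ≤ δ → ∀ {z} → (∀ j → T (adj G z j) → σ j ≡ cut) → deg G z ≡ δ
cut-neighbourhood⇒deg≡δ G σ δ≤deg ∣cut∣≤δ {z} nbrs = ≤-antisym (begin
  deg G z            ≡⟨ count-tabulate (adj G z) ⟩
  count (adj G z)    ≤⟨ count-mono (λ j zj → ≡⇒T⁻¹ {σ = σ} (nbrs j zj)) ⟩
  count (σ ⁻¹ cut)   ≤⟨ ∣cut∣≤δ ⟩
  _                  ∎) (δ≤deg z)
  where open ≤-Reasoning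

isolated-vertex : ∀ {n δ} (G : Graph n) (σ : Fin n → Side) → Separates G σ →
  sum (codeg G) + 4 * δ + 6 ≤ 4 * n → ∀ {w} → deg G w ≡ δ → count (σ ⁻¹ cut) ≤ δ →
  ∀ {u v} → σ u ≡ left → σ v ≡ right → ¬ Exceptional G δ →
  ∃ λ z → σ z ≢ cut × (∀ j → T (adj G z j) → σ j ≡ cut)
isolated-vertex {n} {δ} G σ sep bound {w} dw ∣cut∣≤δ {u} {v} σu σv notExc
  with count (σ ⁻¹ left) ≤? 1 | count (σ ⁻¹ right) ≤? 1
... | yes ∣left∣≤1 | _ = u , subst (_≢ cut) (sym σu) (λ ()) , alone⇒isolated (λ ()) σu ∣left∣≤1
  where open Separated G σ sep
... | no _ | yes ∣right∣≤1 = v , subst (_≢ cut) (sym σv) (λ ()) , alone⇒isolated (λ ()) σv ∣right∣≤1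
  where open Separated G σ sep
... | no ∣left∣≰1 | no ∣right∣≰1 = by-side (σ w) refl
  where
  open Separated G σ sep
  2≤∣left∣ : 2 ≤ ∣left∣
  2≤∣left∣ = ≰⇒> ∣left∣≰1
  2≤∣right∣ : 2 ≤ ∣right∣
  2≤∣right∣ = ≰⇒> ∣right∣≰1
  by-side : ∀ c → σ w ≡ c → ∃ λ z → σ z ≢ cut × (∀ j → T (adj G z j) → σ j ≡ cut)
  by-side cut σw = contradiction (cut-codeg-bound σw)
    (cut-case-arith bound (trans (cong (λ d → d + codeg G w + 1) (sym dw)) (deg+codeg G w))
                    (count-sides σ) ∣cut∣≤δ 2≤∣left∣ 2≤∣right∣)
  by-side left σw =
    [ (λ nbrs → w , subst (_≢ cut) (sym σw) (λ ()) , nbrs)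
    , (λ exc → contradiction exc notExc)
    ]′ (VertexOnLeft.isolated-or-exceptional G σ sep w σw bound dw ∣cut∣≤δ 2≤∣left∣ 2≤∣right∣)
  by-side right σw =
    [ (λ nbrs → w , subst (_≢ cut) (sym σw) (λ ()) , λ j wj → mirror≡cut (nbrs j wj))
    , (λ exc → contradiction exc notExc)
    ]′ (VertexOnLeft.isolated-or-exceptional G (mirror ∘ σ) (separates-mirror {G = G} sep) w (cong mirror σw)
          bound dw (subst (_≤ δ) (sym (count-mirror σ cut)) ∣cut∣≤δ)
          (subst (2 ≤_) (sym (count-mirror σ left)) 2≤∣right∣)
          (subst (2 ≤_) (sym (count-mirror σ right)) 2≤∣left∣))

theorem4p1 : (n : ℕ) → 5 ≤ n → (G : Graph n) → Connected G →
    (δ : ℕ) → IsMinDegree G δ →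
    ((n ∸ 2) C 2) + 2 * δ ≤ size G →
    ¬ Exceptional G δ → SuperKappa G δ
theorem4p1 zero () _ _ _ _ _ _
theorem4p1 (suc zero) (s≤s ()) _ _ _ _ _ _
theorem4p1 (suc (suc m)) _ G _ δ ((w , dw) , δ≤deg) dense notExc
           S minCut@((u , v , u∉S , v∉S , ¬u⇝v) , _) =
  conclude (isolated-vertex G side side-separates (codeg-sum-bound m G δ dense) dw ∣cut∣≤δ
                            side-u (side-unreachable v∉S ¬u⇝v) notExc)
  where
  open ComponentOf G S u u∉S
  ∣cut∣≤δ : count (side ⁻¹ cut) ≤ δ
  ∣cut∣≤δ = subst (_≤ δ) (trans (count-lookup S) (sym (sum-cong-≗ (cong 𝟙 ∘ ⁻¹cut≗lookup))))
                  (minVertexCut≤minDegree G dw δ≤deg S minCut)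
  conclude : (∃ λ z → side z ≢ cut × (∀ j → T (adj G z j) → side j ≡ cut)) →
             ∃ λ z → z ∉ S × (∀ j → T (adj G z j) → j ∈ S) × deg G z ≡ δ
  conclude (z , z∉cut , nbrs) = z , side≢cut⇒∉ z z∉cut , (λ j zj → side≡cut⇒∈ j (nbrs j zj)) ,
                                cut-neighbourhood⇒deg≡δ G side δ≤deg ∣cut∣≤δ nbrs
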